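{- Let $a$ be an integer with $a\notin\{0,1,-1\}$, and let $p$ be an odd prime with $p\nmid 3a(2-a)(a^3+1)$. Let $\{u_n\}_{n\geq0}$ be defined by $u_0=0$, $u_1=1$, $u_{n+1}=(2-a)u_n-(a^2-a+1)u_{n-1}$ for $n\geq1$. Then, if $p\equiv1\pmod3$, $$\frac{u_{p-1}}{p}\equiv\frac{2}{3a^2}\sum_{k=1}^{\frac{p-1}{3}}\frac{(-a)^{3k}}{k}+\frac{1}{3a^2}\Big((2-a)q_p(a^2-a+1)+2(a+1)q_p(a+1)\Big)\pmod p;$$ and if $p\equiv2\pmod3$, $$\frac{u_{p+1}}{p}\equiv-\frac{2(a^2-a+1)}{3a^2}\sum_{k=1}^{\frac{p-2}{3}}\frac{(-a)^{3k}}{k}-\frac{a^2-a+1}{3a^2}\Big((2-a)q_p(a^2-a+1)+2(a+1)q_p(a+1)\Big)\pmod p.$$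
   Context: For an odd prime $p$ and an integer $x$ with $p\nmid x$, $q_p(x)=\frac{x^{p-1}-1}{p}$. Congruences modulo $p$ between rationals with denominators prime to $p$ are understood in the ring of $p$-integral rationals. -}

module Defs where

open import Data.Nat as ℕ using (ℕ; zero; suc; _∸_)
open import Data.Nat.Divisibility as ℕD using ()
open import Data.Integer as ℤ using (ℤ; +_; +[1+_]; -[1+_])
open import Data.Rational as ℚ using (ℚ; mkℚ; 0ℚ; 1ℚ; _+_; _-_; _*_; 1/_; ↧ₙ_)
open import Data.Product using (Σ; _×_)
open import Relation.Nullary using (¬_)
open import Relation.Binary.PropositionalEquality using (_≡_)

ι : ℤ → ℚ
ι z = z ℚ./ 1

-- total division on ℚ: x ⊘ y = x / y when y ≠ 0 (and 0 when y = 0;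
-- that case never occurs in the statement under its hypotheses)
_⊘_ : ℚ → ℚ → ℚ
x ⊘ mkℚ (+ zero) _ _ = 0ℚ
x ⊘ y@(mkℚ +[1+ n ] _ _) = x * (1/ y)
x ⊘ y@(mkℚ -[1+ n ] _ _) = x * (1/ y)
infixl 7 _⊘_

sum1 : ℕ → (ℕ → ℚ) → ℚ
sum1 zero f = 0ℚ
sum1 (suc m) f = sum1 m f + f (suc m)

q : ℕ → ℤ → ℚ
q p x = ι (x ℤ.^ (p ∸ 1) ℤ.- ℤ.1ℤ) ⊘ ι (+ p)

pIntegral : ℕ → ℚ → Set
pIntegral p z = ¬ (p ℕD.∣ ↧ₙ z)

_≡_[modℚ_] : ℚ → ℚ → ℕ → Set
x ≡ y [modℚ p ] = Σ ℚ (λ z → pIntegral p z × (x - y ≡ ι (+ p) * z))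

u : ℤ → ℕ → ℤ
u a zero = ℤ.0ℤ
u a (suc zero) = ℤ.1ℤ
u a (suc (suc n)) = (ℤ.+ 2 ℤ.- a) ℤ.* u a (suc n) ℤ.- (a ℤ.* a ℤ.- a ℤ.+ ℤ.1ℤ) ℤ.* u a n

-- Work in ℤ[σ]/(σ³ - 1). The components t₀, t₁, t₂ of (1 + aσ)ⁿ split the binomial expansion of
-- (1 + a)ⁿ by the residue of the index mod 3, and evaluating at a primitive cube root of unity gives
-- a uₙ = t₁ - t₂, t₀ + t₁ + t₂ = (a + 1)ⁿ and t₀² + t₁² + t₂² - t₀t₁ - t₁t₂ - t₂t₀ = (a² - a + 1)ⁿ.
-- For n = p every C(p,k) with 0 < k < p is divisible by p, so with Fermat's little theorem (which
-- follows from the same decomposition) (1 + aσ)ᵖ = 1 + aσᵖ + pW for an integral W, and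
-- C(p,k)/p ≡ (-1)^(k-1)/k identifies t₀(W) with -(1/3) Σ (-a)^(3k)/k modulo p. Expanding the three
-- identities to first order in p expresses u_{p∓1}/p, q_p(a + 1) and q_p(a² - a + 1) through W,
-- after which the theorem is a polynomial identity.
module Submission where

open import Level using (0ℓ)
open import Data.Empty using (⊥-elim)
open import Data.Product using (Σ; _×_; _,_; proj₁; proj₂)
open import Data.Sum using (inj₁; inj₂)
open import Relation.Nullary using (¬_)
open import Relation.Nullary.Decidable using (recompute)
open import Relation.Binary.Bundles using (Setoid)
open import Relation.Binary.Definitions using (tri<; tri≈; tri>)
open import Relation.Binary.PropositionalEquality
import Relation.Binary.Reasoning.Setoid as ≈-Reasoning

open import Data.Nat as ℕ using (ℕ; zero; suc; _∸_; _%_; _/_; z≤n; s≤s)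
import Data.Nat.Properties as ℕ
import Data.Nat.DivMod as ℕ
import Data.Nat.Divisibility as ℕ
import Data.Nat.GCD as ℕ
import Data.Nat.Tactic.RingSolver as ℕ
import Data.Nat.Coprimality as Coprime
open import Data.Nat.Primality using (Prime; euclidsLemma; prime⇒nonZero; prime⇒nonTrivial)
open import Data.Nat.Combinatorics using (_C_; nC1≡n; nCn≡1; nCk+nC[k+1]≡[n+1]C[k+1]; k>n⇒nCk≡0)

open import Data.Integer as ℤ using (ℤ; +_; -[1+_]; +[1+_]; _+_; _*_; _-_; -_; _^_; -1ℤ)
import Data.Integer.Properties as ℤ
import Data.Integer.GCD as ℤ
open import Data.Integer.Divisibility as ℤD using ()
open import Data.Integer.Divisibility.Signed using (_∣_; divides; ∣m∣n⇒∣m+n; ∣m∣n⇒∣m-n; ∣m⇒∣m*n)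
open import Data.Integer.Tactic.RingSolver using (solve-∀)

open import Data.Rational as ℚ using (ℚ; mkℚ; 0ℚ; ↥_; ↧_)
import Data.Rational.Properties as ℚ
import Data.Rational.Unnormalised as ℚᵘ
import Data.Rational.Unnormalised.Properties as ℚᵘ
open import Data.Rational.Solver using (module +-*-Solver)
open +-*-Solver using (solve; _:+_; _:*_; :-_; _:-_; _:=_)

open import Defs

cong₃ : ∀ {A B C D : Set} (f : A → B → C → D) {x x′ y y′ z z′} → x ≡ x′ → y ≡ y′ → z ≡ z′ → f x y z ≡ f x′ y′ z′
cong₃ f refl refl refl = refl

↥ι : ∀ z → ↥ (ι z) ≡ z
↥ι z = begin
  ↥ ι z                           ≡⟨ ℤ.*-identityʳ _ ⟨
  ↥ ι z * + 1                     ≡⟨ cong (λ g → ↥ ι z * + g) (ℕ.gcd-zeroʳ ℤ.∣ z ∣) ⟨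
  ↥ ι z * ℤ.gcd z (+ 1)           ≡⟨ ℚ.↥-/ z 1 ⟩
  z                               ∎
  where open ≡-Reasoning

↧ι : ∀ z → ↧ (ι z) ≡ + 1
↧ι z = begin
  ↧ ι z                           ≡⟨ ℤ.*-identityʳ _ ⟨
  ↧ ι z * + 1                     ≡⟨ cong (λ g → ↧ ι z * + g) (ℕ.gcd-zeroʳ ℤ.∣ z ∣) ⟨
  ↧ ι z * ℤ.gcd z (+ 1)           ≡⟨ ℚ.↧-/ z 1 ⟩
  + 1                             ∎
  where open ≡-Reasoning

toℚᵘ-ι : ∀ z → ℚ.toℚᵘ (ι z) ℚᵘ.≃ ℚᵘ.mkℚᵘ z 0
toℚᵘ-ι z = ℚᵘ.*≡* (cong₂ _*_ (trans (ℚ.↥ᵘ-toℚᵘ (ι z)) (↥ι z)) (sym (trans (ℚ.↧ᵘ-toℚᵘ (ι z)) (↧ι z))))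

private
  ι-via-toℚᵘ : ∀ {z x} → ℚᵘ.mkℚᵘ z 0 ℚᵘ.≃ ℚ.toℚᵘ x → ι z ≡ x
  ι-via-toℚᵘ {z} eq = ℚ.toℚᵘ-injective (ℚᵘ.≃-trans (toℚᵘ-ι z) eq)

ι-+ : ∀ m n → ι (m + n) ≡ ι m ℚ.+ ι n
ι-+ m n = ι-via-toℚᵘ (begin
  ℚᵘ.mkℚᵘ (m + n) 0                       ≈⟨ ℚᵘ.*≡* (lemma m n) ⟩
  ℚᵘ.mkℚᵘ m 0 ℚᵘ.+ ℚᵘ.mkℚᵘ n 0            ≈⟨ ℚᵘ.+-cong (toℚᵘ-ι m) (toℚᵘ-ι n) ⟨
  ℚ.toℚᵘ (ι m) ℚᵘ.+ ℚ.toℚᵘ (ι n)          ≈⟨ ℚ.toℚᵘ-homo-+ (ι m) (ι n) ⟨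
  ℚ.toℚᵘ (ι m ℚ.+ ι n)                    ∎)
  where
  open ℚᵘ.≃-Reasoning
  lemma : ∀ m n → (m + n) * + 1 ≡ (m * + 1 + n * + 1) * + 1
  lemma = solve-∀

ι-* : ∀ m n → ι (m * n) ≡ ι m ℚ.* ι n
ι-* m n = ι-via-toℚᵘ (begin
  ℚᵘ.mkℚᵘ (m * n) 0                       ≈⟨ ℚᵘ.*≡* refl ⟩
  ℚᵘ.mkℚᵘ m 0 ℚᵘ.* ℚᵘ.mkℚᵘ n 0            ≈⟨ ℚᵘ.*-cong (toℚᵘ-ι m) (toℚᵘ-ι n) ⟨
  ℚ.toℚᵘ (ι m) ℚᵘ.* ℚ.toℚᵘ (ι n)          ≈⟨ ℚ.toℚᵘ-homo-* (ι m) (ι n) ⟨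
  ℚ.toℚᵘ (ι m ℚ.* ι n)                    ∎)
  where open ℚᵘ.≃-Reasoning

ι-neg : ∀ m → ι (- m) ≡ ℚ.- ι m
ι-neg m = ι-via-toℚᵘ (begin
  ℚᵘ.mkℚᵘ (- m) 0                         ≈⟨ ℚᵘ.*≡* refl ⟩
  ℚᵘ.- ℚᵘ.mkℚᵘ m 0                        ≈⟨ ℚᵘ.-‿cong (toℚᵘ-ι m) ⟨
  ℚᵘ.- ℚ.toℚᵘ (ι m)                       ≈⟨ ℚ.toℚᵘ-homo‿- (ι m) ⟨
  ℚ.toℚᵘ (ℚ.- ι m)                        ∎)
  where open ℚᵘ.≃-Reasoning

ι-- : ∀ m n → ι (m - n) ≡ ι m ℚ.- ι n
ι-- m n = trans (ι-+ m (- n)) (cong (ι m ℚ.+_) (ι-neg n))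

ι-injective : ∀ {m n} → ι m ≡ ι n → m ≡ n
ι-injective {m} {n} eq = trans (sym (↥ι m)) (trans (cong ↥_ eq) (↥ι n))

ι≢0 : ∀ {d} → d ≢ + 0 → ι d ≢ 0ℚ
ι≢0 d≢0 eq = d≢0 (ι-injective eq)

ι-*-swap : ∀ m n k l → m * n ≡ k * l → ι m ℚ.* ι n ≡ ι k ℚ.* ι l
ι-*-swap m n k l eq = trans (sym (ι-* m n)) (trans (cong ι eq) (ι-* k l))

⊘-inverseʳ : ∀ x {y} → y ≢ 0ℚ → (x ⊘ y) ℚ.* y ≡ x
⊘-inverseʳ x {mkℚ (+ zero) _ _} y≢0 = ⊥-elim (y≢0 (ℚ.↥p≡0⇒p≡0 _ refl))
⊘-inverseʳ x {y@(mkℚ +[1+ _ ] _ _)} _ = trans (ℚ.*-assoc x (ℚ.1/ y) y) (trans (cong (x ℚ.*_) (ℚ.*-inverseˡ y)) (ℚ.*-identityʳ x))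
⊘-inverseʳ x {y@(mkℚ -[1+ _ ] _ _)} _ = trans (ℚ.*-assoc x (ℚ.1/ y) y) (trans (cong (x ℚ.*_) (ℚ.*-inverseˡ y)) (ℚ.*-identityʳ x))

*-⊘-cancelʳ : ∀ x {y} → y ≢ 0ℚ → (x ℚ.* y) ⊘ y ≡ x
*-⊘-cancelʳ x {mkℚ (+ zero) _ _} y≢0 = ⊥-elim (y≢0 (ℚ.↥p≡0⇒p≡0 _ refl))
*-⊘-cancelʳ x {y@(mkℚ +[1+ _ ] _ _)} _ = trans (ℚ.*-assoc x y (ℚ.1/ y)) (trans (cong (x ℚ.*_) (ℚ.*-inverseʳ y)) (ℚ.*-identityʳ x))
*-⊘-cancelʳ x {y@(mkℚ -[1+ _ ] _ _)} _ = trans (ℚ.*-assoc x y (ℚ.1/ y)) (trans (cong (x ℚ.*_) (ℚ.*-inverseʳ y)) (ℚ.*-identityʳ x))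

*-⊘-assoc : ∀ x y z → (x ℚ.* y) ⊘ z ≡ x ℚ.* (y ⊘ z)
*-⊘-assoc x y (mkℚ (+ zero) _ _) = sym (ℚ.*-zeroʳ x)
*-⊘-assoc x y z@(mkℚ +[1+ _ ] _ _) = ℚ.*-assoc x y (ℚ.1/ z)
*-⊘-assoc x y z@(mkℚ -[1+ _ ] _ _) = ℚ.*-assoc x y (ℚ.1/ z)

*ι-cancelʳ : ∀ {x y d} → d ≢ + 0 → x ℚ.* ι d ≡ y ℚ.* ι d → x ≡ y
*ι-cancelʳ {x} {y} {d} d≢0 eq = begin
  x                     ≡⟨ *-⊘-cancelʳ x (ι≢0 d≢0) ⟨
  (x ℚ.* ι d) ⊘ ι d     ≡⟨ cong (_⊘ ι d) eq ⟩
  (y ℚ.* ι d) ⊘ ι d     ≡⟨ *-⊘-cancelʳ y (ι≢0 d≢0) ⟩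
  y                     ∎
  where open ≡-Reasoning

ι-*-⊘ : ∀ m n {d} k → d ≢ + 0 → m * n ≡ k * d → ι m ℚ.* (ι n ⊘ ι d) ≡ ι k
ι-*-⊘ m n {d} k d≢0 eq = *ι-cancelʳ d≢0 (begin
  ι m ℚ.* (ι n ⊘ ι d) ℚ.* ι d       ≡⟨ ℚ.*-assoc (ι m) (ι n ⊘ ι d) (ι d) ⟩
  ι m ℚ.* ((ι n ⊘ ι d) ℚ.* ι d)     ≡⟨ cong (ι m ℚ.*_) (⊘-inverseʳ (ι n) (ι≢0 d≢0)) ⟩
  ι m ℚ.* ι n                       ≡⟨ ι-* m n ⟨
  ι (m * n)                         ≡⟨ cong ι eq ⟩
  ι (k * d)                         ≡⟨ ι-* k d ⟩
  ι k ℚ.* ι d                       ∎)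
  where open ≡-Reasoning

sumℤ : ℕ → (ℕ → ℤ) → ℤ
sumℤ zero    f = + 0
sumℤ (suc n) f = sumℤ n f + f n

sumℤ-cong : ∀ n {f g : ℕ → ℤ} → (∀ k → f k ≡ g k) → sumℤ n f ≡ sumℤ n g
sumℤ-cong zero    f≗g = refl
sumℤ-cong (suc n) f≗g = cong₂ _+_ (sumℤ-cong n f≗g) (f≗g n)

sumℤ-+ : ∀ n (f g : ℕ → ℤ) → sumℤ n (λ k → f k + g k) ≡ sumℤ n f + sumℤ n g
sumℤ-+ zero    f g = refl
sumℤ-+ (suc n) f g = trans (cong (_+ (f n + g n)) (sumℤ-+ n f g)) (lemma (sumℤ n f) (sumℤ n g) (f n) (g n))
  where
  lemma : ∀ a b c d → a + b + (c + d) ≡ a + c + (b + d)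
  lemma = solve-∀

sumℤ-*ˡ : ∀ n c (f : ℕ → ℤ) → sumℤ n (λ k → c * f k) ≡ c * sumℤ n f
sumℤ-*ˡ zero    c f = sym (ℤ.*-zeroʳ c)
sumℤ-*ˡ (suc n) c f = trans (cong (_+ c * f n) (sumℤ-*ˡ n c f)) (sym (ℤ.*-distribˡ-+ c (sumℤ n f) (f n)))

sumℤ-suc : ∀ n (f : ℕ → ℤ) → sumℤ (suc n) f ≡ f 0 + sumℤ n (λ k → f (suc k))
sumℤ-suc zero    f = trans (ℤ.+-identityˡ (f 0)) (sym (ℤ.+-identityʳ (f 0)))
sumℤ-suc (suc n) f = trans (cong (_+ f (suc n)) (sumℤ-suc n f)) (ℤ.+-assoc (f 0) _ _)

sumℤ-zero : ∀ n → sumℤ n (λ _ → + 0) ≡ + 0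
sumℤ-zero zero    = refl
sumℤ-zero (suc n) = cong (_+ + 0) (sumℤ-zero n)

∣-sumℤ : ∀ {d} n {f : ℕ → ℤ} → (∀ k → k ℕ.< n → d ∣ f k) → d ∣ sumℤ n f
∣-sumℤ zero    d∣f = divides (+ 0) refl
∣-sumℤ (suc n) d∣f = ∣m∣n⇒∣m+n (∣-sumℤ n (λ k k<n → d∣f k (ℕ.m<n⇒m<1+n k<n))) (d∣f n (ℕ.n<1+n n))

-- Binomial coefficients modulo a prime

[1+k]*[1+n]C[1+k]≡[1+n]*nCk : ∀ n k → suc k ℕ.* (suc n C suc k) ≡ suc n ℕ.* (n C k)
[1+k]*[1+n]C[1+k]≡[1+n]*nCk zero    zero    = refl
[1+k]*[1+n]C[1+k]≡[1+n]*nCk zero    (suc k) = ℕ.*-zeroʳ (suc (suc k))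
[1+k]*[1+n]C[1+k]≡[1+n]*nCk (suc n) zero    = trans (ℕ.+-identityʳ _) (trans (nC1≡n (suc (suc n))) (sym (ℕ.*-identityʳ (suc (suc n)))))
[1+k]*[1+n]C[1+k]≡[1+n]*nCk (suc n) (suc k) = begin
  suc (suc k) ℕ.* (suc (suc n) C suc (suc k))             ≡⟨ cong (suc (suc k) ℕ.*_) (nCk+nC[k+1]≡[n+1]C[k+1] (suc n) (suc k)) ⟨
  suc (suc k) ℕ.* (X ℕ.+ Y)                               ≡⟨ lemma₁ k X Y ⟩
  X ℕ.+ suc k ℕ.* X ℕ.+ suc (suc k) ℕ.* Y                 ≡⟨ cong₂ (λ a b → X ℕ.+ a ℕ.+ b) ([1+k]*[1+n]C[1+k]≡[1+n]*nCk n k) ([1+k]*[1+n]C[1+k]≡[1+n]*nCk n (suc k)) ⟩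
  X ℕ.+ suc n ℕ.* (n C k) ℕ.+ suc n ℕ.* (n C suc k)       ≡⟨ lemma₂ n X (n C k) (n C suc k) ⟩
  X ℕ.+ suc n ℕ.* (n C k ℕ.+ n C suc k)                   ≡⟨ cong (λ a → X ℕ.+ suc n ℕ.* a) (nCk+nC[k+1]≡[n+1]C[k+1] n k) ⟩
  suc (suc n) ℕ.* X                                       ∎
  where
  open ≡-Reasoning
  X = suc n C suc k
  Y = suc n C suc (suc k)
  lemma₁ : ∀ k x y → suc (suc k) ℕ.* (x ℕ.+ y) ≡ x ℕ.+ suc k ℕ.* x ℕ.+ suc (suc k) ℕ.* y
  lemma₁ = ℕ.solve-∀
  lemma₂ : ∀ n x a b → x ℕ.+ suc n ℕ.* a ℕ.+ suc n ℕ.* b ≡ x ℕ.+ suc n ℕ.* (a ℕ.+ b)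
  lemma₂ = ℕ.solve-∀

prime∣pCk : ∀ {p k} → Prime p → 0 ℕ.< k → k ℕ.< p → p ℕ.∣ p C k
prime∣pCk {suc n} {suc i} p-prime _ k<p
  with euclidsLemma (suc i) (suc n C suc i) p-prime (ℕ.divides (n C i) (trans ([1+k]*[1+n]C[1+k]≡[1+n]*nCk n i) (ℕ.*-comm (suc n) (n C i))))
... | inj₁ p∣k = ⊥-elim (ℕ.<⇒≱ k<p (ℕ.∣⇒≤ p∣k))
... | inj₂ p∣C = p∣C

pos-∣ : ∀ {m n} → m ℕ.∣ n → + m ∣ + n
pos-∣ {m} (ℕ.divides q n≡q*m) = divides (+ q) (trans (cong +_ n≡q*m) (ℤ.pos-* q m))

[p-1]Ck≡[-1]^k : ∀ {n k} → Prime (suc n) → k ℕ.≤ n → + suc n ∣ + (n C k) - -1ℤ ^ k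
[p-1]Ck≡[-1]^k {n} {zero}  _       _   = divides (+ 0) refl
[p-1]Ck≡[-1]^k {n} {suc k} p-prime k<n =
  subst (+ suc n ∣_) (sym step)
    (∣m∣n⇒∣m-n (pos-∣ (prime∣pCk p-prime (s≤s z≤n) (s≤s k<n))) ([p-1]Ck≡[-1]^k p-prime (ℕ.<⇒≤ k<n)))
  where
  open ≡-Reasoning
  lemma : ∀ a b s → b - -1ℤ * s ≡ (a + b) - (a - s)
  lemma = solve-∀
  step : + (n C suc k) - -1ℤ ^ suc k ≡ + (suc n C suc k) - (+ (n C k) - -1ℤ ^ k)
  step = begin
    + (n C suc k) - -1ℤ ^ suc k                        ≡⟨ lemma (+ (n C k)) (+ (n C suc k)) (-1ℤ ^ k) ⟩
    (+ (n C k) + + (n C suc k)) - (+ (n C k) - -1ℤ ^ k) ≡⟨ cong (_- (+ (n C k) - -1ℤ ^ k)) (trans (sym (ℤ.pos-+ (n C k) _)) (cong +_ (nCk+nC[k+1]≡[n+1]C[k+1] n k))) ⟩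
    + (suc n C suc k) - (+ (n C k) - -1ℤ ^ k)           ∎

-x^n≡[-1]^n*x^n : ∀ x n → (- x) ^ n ≡ -1ℤ ^ n * x ^ n
-x^n≡[-1]^n*x^n x zero    = refl
-x^n≡[-1]^n*x^n x (suc n) = trans (cong (- x *_) (-x^n≡[-1]^n*x^n x n)) (lemma x (-1ℤ ^ n) (x ^ n))
  where
  lemma : ∀ x s y → - x * (s * y) ≡ -1ℤ * s * (x * y)
  lemma = solve-∀

-- For 0 < j < p the quotient t = C(p,j) x^j / p satisfies j t ≡ -(-x)^j (mod p),
-- because j C(p,j) = p C(p-1,j-1) and C(p-1,j-1) ≡ (-1)^(j-1).
binomial-quotient : ∀ {p j} → Prime p → 0 ℕ.< j → j ℕ.< p → ∀ x →
                    Σ ℤ λ t → (+ (p C j) * x ^ j ≡ t * + p) × (+ p ∣ + j * t + (- x) ^ j)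
binomial-quotient {suc n} {suc i} p-prime _ j<p x with prime∣pCk p-prime (s≤s z≤n) j<p
... | ℕ.divides q C≡q*p = + q * x ^ suc i , quotient , congruence
  where
  open ≡-Reasoning
  j*q≡C : suc i ℕ.* q ≡ n C i
  j*q≡C = ℕ.*-cancelˡ-≡ _ _ (suc n) (begin
    suc n ℕ.* (suc i ℕ.* q)     ≡⟨ lemma n i q ⟩
    suc i ℕ.* (q ℕ.* suc n)     ≡⟨ cong (suc i ℕ.*_) C≡q*p ⟨
    suc i ℕ.* (suc n C suc i)   ≡⟨ [1+k]*[1+n]C[1+k]≡[1+n]*nCk n i ⟩
    suc n ℕ.* (n C i)           ∎)
    where
    lemma : ∀ n i q → suc n ℕ.* (suc i ℕ.* q) ≡ suc i ℕ.* (q ℕ.* suc n)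
    lemma = ℕ.solve-∀
  quotient : + (suc n C suc i) * x ^ suc i ≡ + q * x ^ suc i * + suc n
  quotient = begin
    + (suc n C suc i) * x ^ suc i   ≡⟨ cong (λ c → + c * x ^ suc i) C≡q*p ⟩
    + (q ℕ.* suc n) * x ^ suc i     ≡⟨ cong (_* x ^ suc i) (ℤ.pos-* q (suc n)) ⟩
    + q * + suc n * x ^ suc i       ≡⟨ lemma (+ q) (+ suc n) (x ^ suc i) ⟩
    + q * x ^ suc i * + suc n       ∎
    where
    lemma : ∀ a b c → a * b * c ≡ a * c * b
    lemma = solve-∀
  congruence : + suc n ∣ + suc i * (+ q * x ^ suc i) + (- x) ^ suc i
  congruence = subst (+ suc n ∣_) (sym (begin
    + suc i * (+ q * x ^ suc i) + (- x) ^ suc i                ≡⟨ cong₂ _+_ (sym (ℤ.*-assoc (+ suc i) (+ q) _)) (-x^n≡[-1]^n*x^n x (suc i)) ⟩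
    + suc i * + q * x ^ suc i + -1ℤ * -1ℤ ^ i * x ^ suc i     ≡⟨ cong (λ c → c * x ^ suc i + -1ℤ * -1ℤ ^ i * x ^ suc i) (trans (sym (ℤ.pos-* (suc i) q)) (cong +_ j*q≡C)) ⟩
    + (n C i) * x ^ suc i + -1ℤ * -1ℤ ^ i * x ^ suc i         ≡⟨ lemma (+ (n C i)) (-1ℤ ^ i) (x ^ suc i) ⟩
    (+ (n C i) - -1ℤ ^ i) * x ^ suc i                         ∎))
    (∣m⇒∣m*n (x ^ suc i) ([p-1]Ck≡[-1]^k {k = i} p-prime (ℕ.<⇒≤ (ℕ.≤-pred j<p))))
    where
    lemma : ∀ c s y → c * y + -1ℤ * s * y ≡ (c - s) * y
    lemma = solve-∀

-- Trisection of the binomial expansion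

record Triple : Set where
  constructor ⟨_,_,_⟩
  field
    t₀ t₁ t₂ : ℤ

open Triple

-- trisection x n = (1 + xσ)ⁿ in ℤ[σ]/(σ³ - 1), so that tᵣ is the sum of C(n,k) xᵏ over k ≡ r (mod 3).
trisection : ℤ → ℕ → Triple
trisection x zero    = ⟨ + 1 , + 0 , + 0 ⟩
trisection x (suc n) = let T = trisection x n in
  ⟨ t₀ T + x * t₂ T , t₁ T + x * t₀ T , t₂ T + x * t₁ T ⟩

total : Triple → ℤ
total T = t₀ T + t₁ T + t₂ T

norm : Triple → ℤ
norm T = t₀ T * t₀ T + t₁ T * t₁ T + t₂ T * t₂ T - t₀ T * t₁ T - t₁ T * t₂ T - t₂ T * t₀ T

polar : Triple → Triple → ℤ
polar V W = + 2 * (t₀ V * t₀ W + t₁ V * t₁ W + t₂ V * t₂ W)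
          - t₀ V * t₁ W - t₁ V * t₀ W - t₁ V * t₂ W - t₂ V * t₁ W - t₂ V * t₀ W - t₀ V * t₂ W

difference : Triple → ℤ
difference T = t₁ T - t₂ T

balance : Triple → ℤ
balance T = + 2 * t₀ T - t₁ T - t₂ T

_+[_]_ : Triple → ℤ → Triple → Triple
V +[ d ] W = ⟨ t₀ V + d * t₀ W , t₁ V + d * t₁ W , t₂ V + d * t₂ W ⟩

total-+[] : ∀ V d W → total (V +[ d ] W) ≡ total V + d * total W
total-+[] V d W = lemma (t₀ V) (t₁ V) (t₂ V) d (t₀ W) (t₁ W) (t₂ W)
  where
  lemma : ∀ a b c d x y z → a + d * x + (b + d * y) + (c + d * z) ≡ a + b + c + d * (x + y + z)
  lemma = solve-∀

norm-+[] : ∀ V d W → norm (V +[ d ] W) ≡ norm V + d * (polar V W + d * norm W)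
norm-+[] V d W = lemma (t₀ V) (t₁ V) (t₂ V) d (t₀ W) (t₁ W) (t₂ W)
  where
  lemma : ∀ a b c d x y z →
    (a + d * x) * (a + d * x) + (b + d * y) * (b + d * y) + (c + d * z) * (c + d * z)
      - (a + d * x) * (b + d * y) - (b + d * y) * (c + d * z) - (c + d * z) * (a + d * x)
    ≡ a * a + b * b + c * c - a * b - b * c - c * a
      + d * (+ 2 * (a * x + b * y + c * z) - a * y - b * x - b * z - c * y - c * x - a * z
             + d * (x * x + y * y + z * z - x * y - y * z - z * x))
  lemma = solve-∀

trisection-total : ∀ x n → total (trisection x n) ≡ (x + + 1) ^ n
trisection-total x zero    = refl
trisection-total x (suc n) = begin
  total (trisection x (suc n))          ≡⟨ lemma x (t₀ T) (t₁ T) (t₂ T) ⟩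
  (x + + 1) * total T                   ≡⟨ cong ((x + + 1) *_) (trisection-total x n) ⟩
  (x + + 1) ^ suc n                     ∎
  where
  open ≡-Reasoning
  T = trisection x n
  lemma : ∀ x a b c → a + x * c + (b + x * a) + (c + x * b) ≡ (x + + 1) * (a + b + c)
  lemma = solve-∀

trisection-norm : ∀ x n → norm (trisection x n) ≡ (x * x - x + + 1) ^ n
trisection-norm x zero    = refl
trisection-norm x (suc n) = begin
  norm (trisection x (suc n))           ≡⟨ lemma x (t₀ T) (t₁ T) (t₂ T) ⟩
  (x * x - x + + 1) * norm T            ≡⟨ cong ((x * x - x + + 1) *_) (trisection-norm x n) ⟩
  (x * x - x + + 1) ^ suc n             ∎
  where
  open ≡-Reasoning
  T = trisection x n
  lemma : ∀ x a b c →
    (a + x * c) * (a + x * c) + (b + x * a) * (b + x * a) + (c + x * b) * (c + x * b)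
      - (a + x * c) * (b + x * a) - (b + x * a) * (c + x * b) - (c + x * b) * (a + x * c)
    ≡ (x * x - x + + 1) * (a * a + b * b + c * c - a * b - b * c - c * a)
  lemma = solve-∀

-- u is the Lucas sequence with roots 1 + xω and 1 + xω², ω³ = 1 ≠ ω, while (1 + xω)ⁿ - (1 + xω²)ⁿ = (t₁ - t₂)(ω - ω²).
u-trisection : ∀ x n → x * u x n ≡ difference (trisection x n)
u-trisection x zero          = ℤ.*-zeroʳ x
u-trisection x (suc zero)    = lemma x
  where
  lemma : ∀ x → x * + 1 ≡ + 0 + x * + 1 - (+ 0 + x * + 0)
  lemma = solve-∀
u-trisection x (suc (suc n)) = begin
  x * ((+ 2 - x) * u x (suc n) - (x * x - x + + 1) * u x n)
    ≡⟨ lemma₁ x (u x (suc n)) (u x n) ⟩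
  (+ 2 - x) * (x * u x (suc n)) - (x * x - x + + 1) * (x * u x n)
    ≡⟨ cong₂ (λ s t → (+ 2 - x) * s - (x * x - x + + 1) * t) (u-trisection x (suc n)) (u-trisection x n) ⟩
  (+ 2 - x) * difference (trisection x (suc n)) - (x * x - x + + 1) * difference T
    ≡⟨ lemma₂ x (t₀ T) (t₁ T) (t₂ T) ⟩
  difference (trisection x (suc (suc n)))
    ∎
  where
  open ≡-Reasoning
  T = trisection x n
  lemma₁ : ∀ x s t → x * ((+ 2 - x) * s - (x * x - x + + 1) * t) ≡ (+ 2 - x) * (x * s) - (x * x - x + + 1) * (x * t)
  lemma₁ = solve-∀
  lemma₂ : ∀ x a b c → (+ 2 - x) * (b + x * a - (c + x * b)) - (x * x - x + + 1) * (b - c)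
                     ≡ b + x * a + x * (a + x * c) - (c + x * b + x * (b + x * a))
  lemma₂ = solve-∀

difference-pred : ∀ x n → + 2 * (x * x - x + + 1) * difference (trisection x n)
                        ≡ (+ 2 - x) * difference (trisection x (suc n)) - x * balance (trisection x (suc n))
difference-pred x n = lemma x (t₀ T) (t₁ T) (t₂ T)
  where
  T = trisection x n
  lemma : ∀ x a b c → + 2 * (x * x - x + + 1) * (b - c)
                    ≡ (+ 2 - x) * (b + x * a - (c + x * b)) - x * (+ 2 * (a + x * c) - (b + x * a) - (c + x * b))
  lemma = solve-∀

difference-suc : ∀ x n → + 2 * difference (trisection x (suc n))
                       ≡ (+ 2 - x) * difference (trisection x n) + x * balance (trisection x n)
difference-suc x n = lemma x (t₀ T) (t₁ T) (t₂ T)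
  where
  T = trisection x n
  lemma : ∀ x a b c → + 2 * (b + x * a - (c + x * b)) ≡ (+ 2 - x) * (b - c) + x * (+ 2 * a - b - c)
  lemma = solve-∀

binomialTerm : ℤ → ℕ → ℕ → ℤ
binomialTerm x n j = + (n C j) * x ^ j

part : ℕ → ℤ → ℕ → ℕ → ℤ
part r x n N = sumℤ N (λ k → binomialTerm x n (r ℕ.+ k ℕ.* 3))

binomialTerm-pascal : ∀ x n j → binomialTerm x (suc n) (suc j) ≡ binomialTerm x n (suc j) + x * binomialTerm x n j
binomialTerm-pascal x n j = begin
  + (suc n C suc j) * x ^ suc j                    ≡⟨ cong (λ c → + c * x ^ suc j) (nCk+nC[k+1]≡[n+1]C[k+1] n j) ⟨
  + (n C j ℕ.+ n C suc j) * (x * x ^ j)            ≡⟨ cong (_* (x * x ^ j)) (ℤ.pos-+ (n C j) (n C suc j)) ⟩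
  (+ (n C j) + + (n C suc j)) * (x * x ^ j)        ≡⟨ lemma x (+ (n C j)) (+ (n C suc j)) (x ^ j) ⟩
  + (n C suc j) * x ^ suc j + x * (+ (n C j) * x ^ j) ∎
  where
  open ≡-Reasoning
  lemma : ∀ x a b y → (a + b) * (x * y) ≡ b * (x * y) + x * (a * y)
  lemma = solve-∀

part-suc : ∀ r x n N → part (suc r) x (suc n) N ≡ part (suc r) x n N + x * part r x n N
part-suc r x n N = begin
  part (suc r) x (suc n) N                                                      ≡⟨ sumℤ-cong N (λ k → binomialTerm-pascal x n (r ℕ.+ k ℕ.* 3)) ⟩
  sumℤ N (λ k → binomialTerm x n (suc r ℕ.+ k ℕ.* 3) + x * binomialTerm x n (r ℕ.+ k ℕ.* 3)) ≡⟨ sumℤ-+ N _ _ ⟩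
  part (suc r) x n N + sumℤ N (λ k → x * binomialTerm x n (r ℕ.+ k ℕ.* 3))    ≡⟨ cong (λ s → part (suc r) x n N + s) (sumℤ-*ˡ N x _) ⟩
  part (suc r) x n N + x * part r x n N                                          ∎
  where open ≡-Reasoning

part₀-suc : ∀ x n N → part 0 x (suc n) (suc N) ≡ part 0 x n (suc N) + x * part 2 x n N
part₀-suc x n N = begin
  part 0 x (suc n) (suc N)                               ≡⟨ sumℤ-suc N _ ⟩
  + 1 + sumℤ N (λ k → binomialTerm x (suc n) (suc k ℕ.* 3)) ≡⟨ cong (λ s → + 1 + s) (part-suc 2 x n N) ⟩
  + 1 + (part 3 x n N + x * part 2 x n N)                ≡⟨ ℤ.+-assoc (+ 1) (part 3 x n N) (x * part 2 x n N) ⟨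
  + 1 + part 3 x n N + x * part 2 x n N                  ≡⟨ cong (_+ x * part 2 x n N) (sumℤ-suc N _) ⟨
  part 0 x n (suc N) + x * part 2 x n N                  ∎
  where open ≡-Reasoning

trisection-binomial : ∀ x N n → n ℕ.≤ 2 ℕ.+ N ℕ.* 3 →
                      trisection x n ≡ ⟨ part 0 x n (suc N) , part 1 x n (suc N) , part 2 x n (suc N) ⟩
trisection-binomial x N zero    _ =
  cong₃ ⟨_,_,_⟩ (sym (trans (sumℤ-suc N _) (cong (λ s → + 1 + s) (sumℤ-zero N)))) (sym (sumℤ-zero (suc N))) (sym (sumℤ-zero (suc N)))
trisection-binomial x N (suc n) n<2+3N = begin
  trisection x (suc n)
    ≡⟨ cong (λ T → ⟨ t₀ T + x * t₂ T , t₁ T + x * t₀ T , t₂ T + x * t₁ T ⟩) (trisection-binomial x N n (ℕ.<⇒≤ n<2+3N)) ⟩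
  ⟨ part 0 x n (suc N) + x * part 2 x n (suc N) , part 1 x n (suc N) + x * part 0 x n (suc N) , part 2 x n (suc N) + x * part 1 x n (suc N) ⟩
    ≡⟨ cong₃ ⟨_,_,_⟩ (trans (cong (λ P → part 0 x n (suc N) + x * P) last-vanishes) (sym (part₀-suc x n N)))
               (sym (part-suc 0 x n (suc N))) (sym (part-suc 1 x n (suc N))) ⟩
  ⟨ part 0 x (suc n) (suc N) , part 1 x (suc n) (suc N) , part 2 x (suc n) (suc N) ⟩
    ∎
  where
  open ≡-Reasoning
  last-vanishes : part 2 x n (suc N) ≡ part 2 x n N
  last-vanishes = begin
    part 2 x n N + + (n C (2 ℕ.+ N ℕ.* 3)) * x ^ (2 ℕ.+ N ℕ.* 3) ≡⟨ cong (λ c → part 2 x n N + + c * x ^ (2 ℕ.+ N ℕ.* 3)) (k>n⇒nCk≡0 n<2+3N) ⟩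
    part 2 x n N + + 0                                           ≡⟨ ℤ.+-identityʳ _ ⟩
    part 2 x n N                                                 ∎

-- The trisection of (1 + x)ᵖ modulo p

residue-injective : ∀ {r s} k m → r ℕ.< 3 → s ℕ.< 3 → r ℕ.+ k ℕ.* 3 ≡ s ℕ.+ m ℕ.* 3 → r ≡ s
residue-injective {r} {s} k m r<3 s<3 eq = begin
  r                       ≡⟨ ℕ.m<n⇒m%n≡m r<3 ⟨
  r % 3                   ≡⟨ ℕ.[m+kn]%n≡m%n r k 3 ⟨
  (r ℕ.+ k ℕ.* 3) % 3     ≡⟨ cong (_% 3) eq ⟩
  (s ℕ.+ m ℕ.* 3) % 3     ≡⟨ ℕ.[m+kn]%n≡m%n s m 3 ⟩
  s % 3                   ≡⟨ ℕ.m<n⇒m%n≡m s<3 ⟩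
  s                       ∎
  where open ≡-Reasoning

quotient-injective : ∀ r k m → r ℕ.+ k ℕ.* 3 ≡ r ℕ.+ m ℕ.* 3 → k ≡ m
quotient-injective r k m eq = ℕ.*-cancelʳ-≡ k m 3 (ℕ.+-cancelˡ-≡ r _ _ eq)

binomialTerm-divisible : ∀ {p j} → Prime p → 0 ℕ.< j → j ≢ p → ∀ x → + p ∣ binomialTerm x p j
binomialTerm-divisible {p} {j} p-prime 0<j j≢p x with ℕ.<-cmp j p
... | tri< j<p _ _ = ∣m⇒∣m*n (x ^ j) (pos-∣ (prime∣pCk p-prime 0<j j<p))
... | tri≈ _ j≡p _ = ⊥-elim (j≢p j≡p)
... | tri> _ _ j>p = subst (λ c → + p ∣ + c * x ^ j) (sym (k>n⇒nCk≡0 j>p)) (divides (+ 0) refl)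

part-divisible : ∀ {p} r N → Prime p → (∀ k → k ℕ.< N → suc r ℕ.+ k ℕ.* 3 ≢ p) → ∀ x → + p ∣ part (suc r) x p N
part-divisible r N p-prime avoids-p x = ∣-sumℤ N (λ k k<N → binomialTerm-divisible p-prime (s≤s z≤n) (avoids-p k k<N) x)

binomialTerm-diagonal : ∀ x n → binomialTerm x n n ≡ x ^ n
binomialTerm-diagonal x n = trans (cong (λ c → + c * x ^ n) (nCn≡1 n)) (ℤ.*-identityˡ (x ^ n))

part₀-prime : ∀ {p} m → Prime p → (∀ k → suc k ℕ.* 3 ≢ p) → ∀ x →
              Σ ℤ λ w → (part 0 x p (suc m) ≡ + 1 + + p * w) × (sumℤ m (λ k → binomialTerm x p (suc k ℕ.* 3)) ≡ w * + p)
part₀-prime m p-prime avoids-p x with ∣-sumℤ m (λ k _ → binomialTerm-divisible p-prime (s≤s z≤n) (avoids-p k) x)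
... | divides w sum≡w*p = w , trans (sumℤ-suc m _) (cong (λ s → + 1 + s) (trans sum≡w*p (ℤ.*-comm w _))) , sum≡w*p

trisection-mod-p₁ : ∀ {p} m → Prime p → p ≡ 1 ℕ.+ m ℕ.* 3 → ∀ x →
                    Σ Triple λ W → (trisection x p ≡ ⟨ + 1 , x ^ p , + 0 ⟩ +[ + p ] W)
                                 × (sumℤ m (λ k → binomialTerm x p (suc k ℕ.* 3)) ≡ t₀ W * + p)
trisection-mod-p₁ m p-prime refl x
  with part₀-prime m p-prime (λ k eq → ℕ.0≢1+n (residue-injective (suc k) m (s≤s z≤n) (s≤s (s≤s z≤n)) eq)) x
     | part-divisible 0 m p-prime (λ k k<m eq → ℕ.<⇒≢ k<m (quotient-injective 1 k m eq)) x
     | part-divisible 1 (suc m) p-prime (λ k _ eq → ℕ.1+n≢n (residue-injective k m ℕ.≤-refl (s≤s (s≤s z≤n)) eq)) x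
... | w₀ , e₀ , sum≡w₀p | divides w₁ e₁ | divides w₂ e₂ = ⟨ w₀ , w₁ , w₂ ⟩ , T≡ , sum≡w₀p
  where
  p = 1 ℕ.+ m ℕ.* 3
  T≡ : trisection x p ≡ ⟨ + 1 + + p * w₀ , x ^ p + + p * w₁ , + 0 + + p * w₂ ⟩
  T≡ = trans (trisection-binomial x m p (ℕ.n≤1+n p))
    (cong₃ ⟨_,_,_⟩ e₀
      (trans (cong₂ _+_ e₁ (binomialTerm-diagonal x p)) (trans (ℤ.+-comm (w₁ * + p) (x ^ p)) (cong (λ y → x ^ p + y) (ℤ.*-comm w₁ (+ p)))))
      (trans e₂ (trans (ℤ.*-comm w₂ (+ p)) (sym (ℤ.+-identityˡ _)))))

trisection-mod-p₂ : ∀ {p} m → Prime p → p ≡ 2 ℕ.+ m ℕ.* 3 → ∀ x →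
                    Σ Triple λ W → (trisection x p ≡ ⟨ + 1 , + 0 , x ^ p ⟩ +[ + p ] W)
                                 × (sumℤ m (λ k → binomialTerm x p (suc k ℕ.* 3)) ≡ t₀ W * + p)
trisection-mod-p₂ m p-prime refl x
  with part₀-prime m p-prime (λ k eq → ℕ.0≢1+n (residue-injective (suc k) m (s≤s z≤n) ℕ.≤-refl eq)) x
     | part-divisible 0 (suc m) p-prime (λ k _ eq → ℕ.1+n≢n (sym (residue-injective k m (s≤s (s≤s z≤n)) ℕ.≤-refl eq))) x
     | part-divisible 1 m p-prime (λ k k<m eq → ℕ.<⇒≢ k<m (quotient-injective 2 k m eq)) x
... | w₀ , e₀ , sum≡w₀p | divides w₁ e₁ | divides w₂ e₂ = ⟨ w₀ , w₁ , w₂ ⟩ , T≡ , sum≡w₀p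
  where
  p = 2 ℕ.+ m ℕ.* 3
  T≡ : trisection x p ≡ ⟨ + 1 + + p * w₀ , + 0 + + p * w₁ , x ^ p + + p * w₂ ⟩
  T≡ = trans (trisection-binomial x m p ℕ.≤-refl)
    (cong₃ ⟨_,_,_⟩ e₀
      (trans e₁ (trans (ℤ.*-comm w₁ (+ p)) (sym (ℤ.+-identityˡ _))))
      (trans (cong₂ _+_ e₂ (binomialTerm-diagonal x p)) (trans (ℤ.+-comm (w₂ * + p) (x ^ p)) (cong (λ y → x ^ p + y) (ℤ.*-comm w₂ (+ p))))))

freshman-from-trisection : ∀ {p x} V W → total V ≡ x ^ p + + 1 → trisection x p ≡ V +[ + p ] W →
                           + p ∣ (x + + 1) ^ p - x ^ p - + 1
freshman-from-trisection {p} {x} V W total≡ T≡ = divides (total W) (begin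
  (x + + 1) ^ p - x ^ p - + 1                 ≡⟨ cong (λ y → y - x ^ p - + 1) (trans (sym (trisection-total x p)) (cong total T≡)) ⟩
  total (V +[ + p ] W) - x ^ p - + 1          ≡⟨ cong (λ y → y - x ^ p - + 1) (trans (total-+[] V (+ p) W) (cong (_+ + p * total W) total≡)) ⟩
  x ^ p + + 1 + + p * total W - x ^ p - + 1   ≡⟨ lemma (x ^ p) (+ p) (total W) ⟩
  total W * + p                               ∎)
  where
  open ≡-Reasoning
  lemma : ∀ y d t → y + + 1 + d * t - y - + 1 ≡ t * d
  lemma = solve-∀

fermat-from-freshman : ∀ p .{{_ : ℕ.NonZero p}} → (∀ x → + p ∣ (x + + 1) ^ p - x ^ p - + 1) → ∀ x → + p ∣ x ^ p - x
fermat-from-freshman (suc n) freshman = fermat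
  where
  p = suc n
  step-up : ∀ x → + p ∣ x ^ p - x → + p ∣ (x + + 1) ^ p - (x + + 1)
  step-up x h = subst (+ p ∣_) (lemma ((x + + 1) ^ p) (x ^ p) x) (∣m∣n⇒∣m+n (freshman x) h)
    where
    lemma : ∀ y z x → y - z - + 1 + (z - x) ≡ y - (x + + 1)
    lemma = solve-∀
  step-down : ∀ x → + p ∣ (x + + 1) ^ p - (x + + 1) → + p ∣ x ^ p - x
  step-down x h = subst (+ p ∣_) (lemma ((x + + 1) ^ p) (x ^ p) x) (∣m∣n⇒∣m-n h (freshman x))
    where
    lemma : ∀ y z x → y - (x + + 1) - (y - z - + 1) ≡ z - x
    lemma = solve-∀
  fermat : ∀ x → + p ∣ x ^ p - x
  fermat (+ zero)      = subst (λ z → + p ∣ z - + 0) (sym (ℤ.*-zeroˡ ((+ 0) ^ n))) (divides (+ 0) refl)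
  fermat (+ suc m)     = subst (λ z → + p ∣ z ^ p - z) (trans (sym (ℤ.pos-+ m 1)) (cong +_ (ℕ.+-comm m 1))) (step-up (+ m) (fermat (+ m)))
  fermat -[1+ zero ]   = step-down -[1+ zero ] (fermat (+ 0))
  fermat -[1+ suc m ]  = step-down -[1+ suc m ] (fermat -[1+ m ])

fermat-absorbed : ∀ {p x} α w → x ^ p - x ≡ α * + p → x ^ p + + p * w ≡ x + + p * (α + w)
fermat-absorbed {p} {x} α w e = begin
  x ^ p + + p * w                  ≡⟨ lemma (x ^ p) x (+ p) w ⟩
  x + (x ^ p - x) + + p * w        ≡⟨ cong (λ d → x + d + + p * w) e ⟩
  x + α * + p + + p * w            ≡⟨ lemma′ x α (+ p) w ⟩
  x + + p * (α + w)                ∎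
  where
  open ≡-Reasoning
  lemma : ∀ y x d w → y + d * w ≡ x + (y - x) + d * w
  lemma = solve-∀
  lemma′ : ∀ x α d w → x + α * d + d * w ≡ x + d * (α + w)
  lemma′ = solve-∀

frobenius₁ : ∀ {p} m → Prime p → p ≡ 1 ℕ.+ m ℕ.* 3 → ∀ x →
             Σ Triple λ W → (trisection x p ≡ ⟨ + 1 , x , + 0 ⟩ +[ + p ] W)
                          × (sumℤ m (λ k → binomialTerm x p (suc k ℕ.* 3)) ≡ t₀ W * + p)
frobenius₁ {p} m p-prime p≡ x
  with trisection-mod-p₁ m p-prime p≡ x | fermat-from-freshman p {{prime⇒nonZero p-prime}} freshman x
  where
  freshman : ∀ y → + p ∣ (y + + 1) ^ p - y ^ p - + 1
  freshman y = let W , T≡ , _ = trisection-mod-p₁ m p-prime p≡ y in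
    freshman-from-trisection ⟨ + 1 , y ^ p , + 0 ⟩ W (lemma (y ^ p)) T≡
    where
    lemma : ∀ z → + 1 + z + + 0 ≡ z + + 1
    lemma = solve-∀
... | ⟨ w₀ , w₁ , w₂ ⟩ , T≡ , sum≡ | divides α e =
  ⟨ w₀ , α + w₁ , w₂ ⟩ , trans T≡ (cong₃ ⟨_,_,_⟩ refl (fermat-absorbed α w₁ e) refl) , sum≡

frobenius₂ : ∀ {p} m → Prime p → p ≡ 2 ℕ.+ m ℕ.* 3 → ∀ x →
             Σ Triple λ W → (trisection x p ≡ ⟨ + 1 , + 0 , x ⟩ +[ + p ] W)
                          × (sumℤ m (λ k → binomialTerm x p (suc k ℕ.* 3)) ≡ t₀ W * + p)
frobenius₂ {p} m p-prime p≡ x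
  with trisection-mod-p₂ m p-prime p≡ x | fermat-from-freshman p {{prime⇒nonZero p-prime}} freshman x
  where
  freshman : ∀ y → + p ∣ (y + + 1) ^ p - y ^ p - + 1
  freshman y = let W , T≡ , _ = trisection-mod-p₂ m p-prime p≡ y in
    freshman-from-trisection ⟨ + 1 , + 0 , y ^ p ⟩ W (lemma (y ^ p)) T≡
    where
    lemma : ∀ z → + 1 + + 0 + z ≡ z + + 1
    lemma = solve-∀
... | ⟨ w₀ , w₁ , w₂ ⟩ , T≡ , sum≡ | divides α e =
  ⟨ w₀ , w₁ , α + w₂ ⟩ , trans T≡ (cong₃ ⟨_,_,_⟩ refl refl (fermat-absorbed α w₂ e)) , sum≡

-- Fermat quotients and the Lucas sequence at p ∓ 1

Φ₆ : ℤ → ℤ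
Φ₆ x = x * x - x + + 1

total-quotient : ∀ {x n} V W → total V ≡ x + + 1 → trisection x (suc n) ≡ V +[ + suc n ] W →
                 (x + + 1) * ((x + + 1) ^ n - + 1) ≡ total W * + suc n
total-quotient {x} {n} V W total≡ T≡ = begin
  (x + + 1) * ((x + + 1) ^ n - + 1)           ≡⟨ lemma₁ (x + + 1) ((x + + 1) ^ n) ⟩
  (x + + 1) ^ suc n - (x + + 1)               ≡⟨ cong (_- (x + + 1)) (trans (sym (trisection-total x (suc n))) (cong total T≡)) ⟩
  total (V +[ + suc n ] W) - (x + + 1)        ≡⟨ cong (_- (x + + 1)) (trans (total-+[] V (+ suc n) W) (cong (_+ + suc n * total W) total≡)) ⟩
  x + + 1 + + suc n * total W - (x + + 1)     ≡⟨ lemma₂ (x + + 1) (+ suc n) (total W) ⟩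
  total W * + suc n                           ∎
  where
  open ≡-Reasoning
  lemma₁ : ∀ y z → y * (z - + 1) ≡ y * z - y
  lemma₁ = solve-∀
  lemma₂ : ∀ y d t → y + d * t - y ≡ t * d
  lemma₂ = solve-∀

norm-quotient : ∀ {x n} V W → norm V ≡ Φ₆ x → trisection x (suc n) ≡ V +[ + suc n ] W →
                Φ₆ x * (Φ₆ x ^ n - + 1) ≡ (polar V W + + suc n * norm W) * + suc n
norm-quotient {x} {n} V W norm≡ T≡ = begin
  Φ₆ x * (Φ₆ x ^ n - + 1)                                      ≡⟨ lemma₁ (Φ₆ x) (Φ₆ x ^ n) ⟩
  Φ₆ x ^ suc n - Φ₆ x                                          ≡⟨ cong (_- Φ₆ x) (trans (sym (trisection-norm x (suc n))) (cong norm T≡)) ⟩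
  norm (V +[ + suc n ] W) - Φ₆ x                               ≡⟨ cong (_- Φ₆ x) (trans (norm-+[] V (+ suc n) W) (cong (_+ _) norm≡)) ⟩
  Φ₆ x + + suc n * (polar V W + + suc n * norm W) - Φ₆ x       ≡⟨ lemma₂ (Φ₆ x) (+ suc n) (polar V W + + suc n * norm W) ⟩
  (polar V W + + suc n * norm W) * + suc n                     ∎
  where
  open ≡-Reasoning
  lemma₁ : ∀ y z → y * (z - + 1) ≡ y * z - y
  lemma₁ = solve-∀
  lemma₂ : ∀ y d t → y + d * t - y ≡ t * d
  lemma₂ = solve-∀

-- Equal to 6a³Φ₆(a)·u_{p-1}/p when p ≡ 1 and to -6a³·u_{p+1}/p when p ≡ 2 (mod 3); modulo p it is
-- also 6a³Φ₆(a) times the right-hand side.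
lucasResidue : ℤ → Triple → Triple → ℤ
lucasResidue a V W = a * (- (+ 12) * Φ₆ a * t₀ W + + 2 * (+ 2 - a) * polar V W + + 4 * Φ₆ a * total W)

lucas-quotient₁ : ∀ a n W → trisection a (suc n) ≡ ⟨ + 1 , a , + 0 ⟩ +[ + suc n ] W →
                  + 6 * a * a * a * Φ₆ a * u a n ≡ lucasResidue a ⟨ + 1 , a , + 0 ⟩ W * + suc n
lucas-quotient₁ a n W T≡ = begin
  + 6 * a * a * a * Φ₆ a * u a n                                                   ≡⟨ lemma₁ a (u a n) ⟩
  + 3 * a * a * (+ 2 * Φ₆ a * (a * u a n))                                          ≡⟨ cong (λ y → + 3 * a * a * (+ 2 * Φ₆ a * y)) (u-trisection a n) ⟩
  + 3 * a * a * (+ 2 * Φ₆ a * difference (trisection a n))                          ≡⟨ cong (+ 3 * a * a *_) (difference-pred a n) ⟩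
  + 3 * a * a * ((+ 2 - a) * difference (trisection a (suc n)) - a * balance (trisection a (suc n)))
    ≡⟨ cong (λ T → + 3 * a * a * ((+ 2 - a) * difference T - a * balance T)) T≡ ⟩
  + 3 * a * a * ((+ 2 - a) * difference V+pW - a * balance V+pW)                    ≡⟨ lemma₂ a (+ suc n) (t₀ W) (t₁ W) (t₂ W) ⟩
  lucasResidue a ⟨ + 1 , a , + 0 ⟩ W * + suc n                                      ∎
  where
  open ≡-Reasoning
  V+pW = ⟨ + 1 , a , + 0 ⟩ +[ + suc n ] W
  lemma₁ : ∀ a u → + 6 * a * a * a * (a * a - a + + 1) * u ≡ + 3 * a * a * (+ 2 * (a * a - a + + 1) * (a * u))
  lemma₁ = solve-∀
  lemma₂ : ∀ a d x y z →
    + 3 * a * a * ((+ 2 - a) * (a + d * y - (+ 0 + d * z)) - a * (+ 2 * (+ 1 + d * x) - (a + d * y) - (+ 0 + d * z)))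
    ≡ a * (- (+ 12) * (a * a - a + + 1) * x
           + + 2 * (+ 2 - a) * (+ 2 * (+ 1 * x + a * y + + 0 * z) - + 1 * y - a * x - a * z - + 0 * y - + 0 * x - + 1 * z)
           + + 4 * (a * a - a + + 1) * (x + y + z)) * d
  lemma₂ = solve-∀

lucas-quotient₂ : ∀ a n W → trisection a (suc n) ≡ ⟨ + 1 , + 0 , a ⟩ +[ + suc n ] W →
                  + 6 * a * a * a * u a (suc (suc n)) ≡ - lucasResidue a ⟨ + 1 , + 0 , a ⟩ W * + suc n
lucas-quotient₂ a n W T≡ = begin
  + 6 * a * a * a * u a (suc (suc n))                                               ≡⟨ lemma₁ a (u a (suc (suc n))) ⟩
  + 3 * a * a * (+ 2 * (a * u a (suc (suc n))))                                     ≡⟨ cong (λ y → + 3 * a * a * (+ 2 * y)) (u-trisection a (suc (suc n))) ⟩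
  + 3 * a * a * (+ 2 * difference (trisection a (suc (suc n))))                     ≡⟨ cong (+ 3 * a * a *_) (difference-suc a (suc n)) ⟩
  + 3 * a * a * ((+ 2 - a) * difference (trisection a (suc n)) + a * balance (trisection a (suc n)))
    ≡⟨ cong (λ T → + 3 * a * a * ((+ 2 - a) * difference T + a * balance T)) T≡ ⟩
  + 3 * a * a * ((+ 2 - a) * difference V+pW + a * balance V+pW)                    ≡⟨ lemma₂ a (+ suc n) (t₀ W) (t₁ W) (t₂ W) ⟩
  - lucasResidue a ⟨ + 1 , + 0 , a ⟩ W * + suc n                                     ∎
  where
  open ≡-Reasoning
  V+pW = ⟨ + 1 , + 0 , a ⟩ +[ + suc n ] W
  lemma₁ : ∀ a u → + 6 * a * a * a * u ≡ + 3 * a * a * (+ 2 * (a * u))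
  lemma₁ = solve-∀
  lemma₂ : ∀ a d x y z →
    + 3 * a * a * ((+ 2 - a) * (+ 0 + d * y - (a + d * z)) + a * (+ 2 * (+ 1 + d * x) - (+ 0 + d * y) - (a + d * z)))
    ≡ - (a * (- (+ 12) * (a * a - a + + 1) * x
              + + 2 * (+ 2 - a) * (+ 2 * (+ 1 * x + + 0 * y + a * z) - + 1 * y - + 0 * x - + 0 * z - a * y - a * x - + 1 * z)
              + + 4 * (a * a - a + + 1) * (x + y + z))) * d
  lemma₂ = solve-∀

reciprocalSum : ℤ → ℕ → ℚ
reciprocalSum x m = sum1 m (λ k → ι ((- x) ^ (3 ℕ.* k)) ⊘ ι (+ k))

-- S, qc and qa stand for the sum, q_p(a² - a + 1) and q_p(a + 1); the index is the residue of p mod 3.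
rightHandSide₁ : ℤ → ℚ → ℚ → ℚ → ℚ
rightHandSide₁ a S qc qa = (ι (+ 2) ⊘ ι (+ 3 * a * a)) ℚ.* S
                         ℚ.+ (ι (+ 1) ⊘ ι (+ 3 * a * a)) ℚ.* (ι (+ 2 - a) ℚ.* qc ℚ.+ ι (+ 2 * (a + + 1)) ℚ.* qa)

rightHandSide₁-expansion : ∀ a S qc qa → + 3 * a * a ≢ + 0 →
  ι (+ 6 * a * a * a * Φ₆ a) ℚ.* rightHandSide₁ a S qc qa
    ≡ ι (+ 4 * a * Φ₆ a) ℚ.* S ℚ.+ ι (+ 2 * a * (+ 2 - a)) ℚ.* (ι (Φ₆ a) ℚ.* qc) ℚ.+ ι (+ 4 * a * Φ₆ a) ℚ.* (ι (a + + 1) ℚ.* qa)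
rightHandSide₁-expansion a S qc qa D≢0 = begin
  ι M ℚ.* (A₁ ℚ.* S ℚ.+ A₂ ℚ.* (B₁ ℚ.* qc ℚ.+ B₂ ℚ.* qa))
    ≡⟨ solve 8 (λ m a₁ s a₂ b₁ x b₂ y → m :* (a₁ :* s :+ a₂ :* (b₁ :* x :+ b₂ :* y))
                                      := (m :* a₁) :* s :+ (m :* a₂) :* b₁ :* x :+ (m :* a₂) :* b₂ :* y)
               refl (ι M) A₁ S A₂ B₁ qc B₂ qa ⟩
  ι M ℚ.* A₁ ℚ.* S ℚ.+ ι M ℚ.* A₂ ℚ.* B₁ ℚ.* qc ℚ.+ ι M ℚ.* A₂ ℚ.* B₂ ℚ.* qa
    ≡⟨ cong₃ (λ x y z → x ℚ.* S ℚ.+ y ℚ.* qc ℚ.+ z ℚ.* qa)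
             (ι-*-⊘ M (+ 2) C₄ D≢0 (lemma₁ a))
             (trans (cong (ℚ._* B₁) (ι-*-⊘ M (+ 1) C₂ D≢0 (lemma₂ a))) (ι-*-swap C₂ (+ 2 - a) C₂′ c (lemma₃ a)))
             (trans (cong (ℚ._* B₂) (ι-*-⊘ M (+ 1) C₂ D≢0 (lemma₂ a))) (ι-*-swap C₂ (+ 2 * (a + + 1)) C₄ (a + + 1) (lemma₄ a))) ⟩
  ι C₄ ℚ.* S ℚ.+ ι C₂′ ℚ.* ι c ℚ.* qc ℚ.+ ι C₄ ℚ.* ι (a + + 1) ℚ.* qa
    ≡⟨ cong₂ (λ x y → ι C₄ ℚ.* S ℚ.+ x ℚ.+ y) (ℚ.*-assoc (ι C₂′) (ι c) qc) (ℚ.*-assoc (ι C₄) (ι (a + + 1)) qa) ⟩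
  ι C₄ ℚ.* S ℚ.+ ι C₂′ ℚ.* (ι c ℚ.* qc) ℚ.+ ι C₄ ℚ.* (ι (a + + 1) ℚ.* qa)
    ∎
  where
  open ≡-Reasoning
  c = Φ₆ a
  M = + 6 * a * a * a * c
  C₄ = + 4 * a * c
  C₂ = + 2 * a * c
  C₂′ = + 2 * a * (+ 2 - a)
  A₁ = ι (+ 2) ⊘ ι (+ 3 * a * a)
  A₂ = ι (+ 1) ⊘ ι (+ 3 * a * a)
  B₁ = ι (+ 2 - a)
  B₂ = ι (+ 2 * (a + + 1))
  lemma₁ : ∀ a → + 6 * a * a * a * (a * a - a + + 1) * + 2 ≡ + 4 * a * (a * a - a + + 1) * (+ 3 * a * a)
  lemma₁ = solve-∀
  lemma₂ : ∀ a → + 6 * a * a * a * (a * a - a + + 1) * + 1 ≡ + 2 * a * (a * a - a + + 1) * (+ 3 * a * a)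
  lemma₂ = solve-∀
  lemma₃ : ∀ a → + 2 * a * (a * a - a + + 1) * (+ 2 - a) ≡ + 2 * a * (+ 2 - a) * (a * a - a + + 1)
  lemma₃ = solve-∀
  lemma₄ : ∀ a → + 2 * a * (a * a - a + + 1) * (+ 2 * (a + + 1)) ≡ + 4 * a * (a * a - a + + 1) * (a + + 1)
  lemma₄ = solve-∀

rightHandSide₂ : ℤ → ℚ → ℚ → ℚ → ℚ
rightHandSide₂ a S qc qa = ℚ.- ((ι (+ 2 * Φ₆ a) ⊘ ι (+ 3 * a * a)) ℚ.* S)
                           ℚ.- (ι (Φ₆ a) ⊘ ι (+ 3 * a * a)) ℚ.* (ι (+ 2 - a) ℚ.* qc ℚ.+ ι (+ 2 * (a + + 1)) ℚ.* qa)

rightHandSide₂≡-Φ₆*rightHandSide₁ : ∀ a S qc qa → rightHandSide₂ a S qc qa ≡ ℚ.- (ι (Φ₆ a) ℚ.* rightHandSide₁ a S qc qa)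
rightHandSide₂≡-Φ₆*rightHandSide₁ a S qc qa = begin
  ℚ.- ((ι (+ 2 * c) ⊘ D) ℚ.* S) ℚ.- (ι c ⊘ D) ℚ.* R
    ≡⟨ cong₂ (λ x y → ℚ.- (x ℚ.* S) ℚ.- y ℚ.* R)
             (trans (cong (_⊘ D) (trans (ι-* (+ 2) c) (ℚ.*-comm (ι (+ 2)) (ι c)))) (*-⊘-assoc (ι c) (ι (+ 2)) D))
             (trans (cong (_⊘ D) (sym (ℚ.*-identityʳ (ι c)))) (*-⊘-assoc (ι c) (ι (+ 1)) D)) ⟩
  ℚ.- (ι c ℚ.* (ι (+ 2) ⊘ D) ℚ.* S) ℚ.- ι c ℚ.* (ι (+ 1) ⊘ D) ℚ.* R
    ≡⟨ solve 5 (λ c a₁ s a₂ r → :- (c :* a₁ :* s) :- c :* a₂ :* r := :- (c :* (a₁ :* s :+ a₂ :* r))) refl (ι c) (ι (+ 2) ⊘ D) S (ι (+ 1) ⊘ D) R ⟩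
  ℚ.- (ι c ℚ.* rightHandSide₁ a S qc qa)
    ∎
  where
  open ≡-Reasoning
  c = Φ₆ a
  D = ι (+ 3 * a * a)
  R = ι (+ 2 - a) ℚ.* qc ℚ.+ ι (+ 2 * (a + + 1)) ℚ.* qa


-- Congruences between p-integral rationals

infix 4 _∤_
_∤_ : ℕ → ℤ → Set
p ∤ d = ¬ (+ p ℤD.∣ d)

module Congruence {p : ℕ} (p-prime : Prime p) where

  private
    1<p : 1 ℕ.< p
    1<p = ℕ.nonTrivial⇒n>1 p {{prime⇒nonTrivial p-prime}}

  ∤-1 : p ∤ (+ 1)
  ∤-1 p∣1 = ℕ.<⇒≱ 1<p (ℕ.∣⇒≤ p∣1)

  ∤-< : ∀ {n} → 0 ℕ.< n → n ℕ.< p → p ∤ (+ n)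
  ∤-< {suc n} _ n<p p∣n = ℕ.<⇒≱ n<p (ℕ.∣⇒≤ p∣n)

  ∤-2 : p ≢ 2 → p ∤ + 2
  ∤-2 p≢2 p∣2 = p≢2 (ℕ.≤-antisym (ℕ.∣⇒≤ p∣2) 1<p)

  ∤⇒≢0 : ∀ {d} → p ∤ d → d ≢ + 0
  ∤⇒≢0 p∤d refl = p∤d (ℕ.divides 0 refl)

  ∤-* : ∀ {a b} → p ∤ a → p ∤ b → p ∤ (a * b)
  ∤-* {a} {b} p∤a p∤b p∣ab
    with euclidsLemma ℤ.∣ a ∣ ℤ.∣ b ∣ p-prime (subst (p ℕ.∣_) (ℤ.abs-* a b) p∣ab)
  ... | inj₁ p∣a = p∤a p∣a
  ... | inj₂ p∣b = p∤b p∣b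

  ∤-*ˡ : ∀ a b → p ∤ (a * b) → p ∤ a
  ∤-*ˡ a b p∤ab p∣a = p∤ab (subst (p ℕ.∣_) (sym (ℤ.abs-* a b)) (ℕ.∣-trans p∣a (ℕ.m∣m*n ℤ.∣ b ∣)))

  record Integral (z : ℚ) : Set where
    constructor integral
    field
      denominator : ℤ
      p∤denominator : p ∤ denominator
      numerator   : ℤ
      clears      : z ℚ.* ι denominator ≡ ι numerator

  integral-ι : ∀ n → Integral (ι n)
  integral-ι n = integral (+ 1) ∤-1 n (ℚ.*-identityʳ (ι n))

  integral-⊘ : ∀ n {d} → p ∤ d → Integral (ι n ⊘ ι d)
  integral-⊘ n {d} p∤d = integral d p∤d n (⊘-inverseʳ (ι n) (ι≢0 (∤⇒≢0 {d} p∤d)))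

  integral-+ : ∀ {x y} → Integral x → Integral y → Integral (x ℚ.+ y)
  integral-+ {x} {y} (integral d₁ u₁ n₁ e₁) (integral d₂ u₂ n₂ e₂) =
    integral (d₁ * d₂) (∤-* {d₁} {d₂} u₁ u₂) (n₁ * d₂ + n₂ * d₁) (begin
      (x ℚ.+ y) ℚ.* ι (d₁ * d₂)                         ≡⟨ cong ((x ℚ.+ y) ℚ.*_) (ι-* d₁ d₂) ⟩
      (x ℚ.+ y) ℚ.* (ι d₁ ℚ.* ι d₂)                     ≡⟨ solve 4 (λ x y a b → (x :+ y) :* (a :* b) := (x :* a) :* b :+ (y :* b) :* a) refl x y (ι d₁) (ι d₂) ⟩
      (x ℚ.* ι d₁) ℚ.* ι d₂ ℚ.+ (y ℚ.* ι d₂) ℚ.* ι d₁   ≡⟨ cong₂ (λ s t → s ℚ.* ι d₂ ℚ.+ t ℚ.* ι d₁) e₁ e₂ ⟩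
      ι n₁ ℚ.* ι d₂ ℚ.+ ι n₂ ℚ.* ι d₁                   ≡⟨ cong₂ ℚ._+_ (ι-* n₁ d₂) (ι-* n₂ d₁) ⟨
      ι (n₁ * d₂) ℚ.+ ι (n₂ * d₁)                       ≡⟨ ι-+ (n₁ * d₂) (n₂ * d₁) ⟨
      ι (n₁ * d₂ + n₂ * d₁)                             ∎)
    where open ≡-Reasoning

  integral-* : ∀ {x y} → Integral x → Integral y → Integral (x ℚ.* y)
  integral-* {x} {y} (integral d₁ u₁ n₁ e₁) (integral d₂ u₂ n₂ e₂) =
    integral (d₁ * d₂) (∤-* {d₁} {d₂} u₁ u₂) (n₁ * n₂) (begin
      (x ℚ.* y) ℚ.* ι (d₁ * d₂)           ≡⟨ cong ((x ℚ.* y) ℚ.*_) (ι-* d₁ d₂) ⟩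
      (x ℚ.* y) ℚ.* (ι d₁ ℚ.* ι d₂)       ≡⟨ solve 4 (λ x y a b → (x :* y) :* (a :* b) := (x :* a) :* (y :* b)) refl x y (ι d₁) (ι d₂) ⟩
      (x ℚ.* ι d₁) ℚ.* (y ℚ.* ι d₂)       ≡⟨ cong₂ ℚ._*_ e₁ e₂ ⟩
      ι n₁ ℚ.* ι n₂                       ≡⟨ ι-* n₁ n₂ ⟨
      ι (n₁ * n₂)                         ∎)
    where open ≡-Reasoning

  integral-neg : ∀ {x} → Integral x → Integral (ℚ.- x)
  integral-neg {x} (integral d u n e) = integral d u (- n) (begin
    ℚ.- x ℚ.* ι d         ≡⟨ solve 2 (λ x a → (:- x) :* a := :- (x :* a)) refl x (ι d) ⟩
    ℚ.- (x ℚ.* ι d)       ≡⟨ cong ℚ.-_ e ⟩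
    ℚ.- ι n               ≡⟨ ι-neg n ⟨
    ι (- n)               ∎)
    where open ≡-Reasoning

  -- z d = n with gcd(↥ z, ↧ z) = 1 forces ↧ z ∣ d, so p ∤ d gives p ∤ ↧ z.
  integral⇒pIntegral : ∀ {z} → Integral z → pIntegral p z
  integral⇒pIntegral {z@(mkℚ N D-1 coprime)} (integral d p∤d n clears) p∣D = p∤d (ℕ.∣-trans p∣D D∣d)
    where
    open ≡-Reasoning
    n≃Nd : ℚᵘ.mkℚᵘ n 0 ℚᵘ.≃ ℚᵘ.mkℚᵘ N D-1 ℚᵘ.* ℚᵘ.mkℚᵘ d 0
    n≃Nd = ℚᵘ.≃-trans (ℚᵘ.≃-sym (toℚᵘ-ι n)) (ℚᵘ.≃-trans (ℚᵘ.≃-reflexive (cong ℚ.toℚᵘ (sym clears)))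
             (ℚᵘ.≃-trans (ℚ.toℚᵘ-homo-* z (ι d)) (ℚᵘ.*-cong (ℚᵘ.≃-refl {ℚᵘ.mkℚᵘ N D-1}) (toℚᵘ-ι d))))
    n*D≡N*d : n * + (suc D-1 ℕ.* 1) ≡ N * d * + 1
    n*D≡N*d with n≃Nd
    ... | ℚᵘ.*≡* eq = eq
    ∣n∣*D≡∣N∣*∣d∣ : ℤ.∣ n ∣ ℕ.* (suc D-1 ℕ.* 1) ≡ ℤ.∣ N ∣ ℕ.* ℤ.∣ d ∣
    ∣n∣*D≡∣N∣*∣d∣ = begin
      ℤ.∣ n ∣ ℕ.* (suc D-1 ℕ.* 1)       ≡⟨ ℤ.abs-* n (+ (suc D-1 ℕ.* 1)) ⟨
      ℤ.∣ n * + (suc D-1 ℕ.* 1) ∣       ≡⟨ cong ℤ.∣_∣ (trans n*D≡N*d (ℤ.*-identityʳ (N * d))) ⟩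
      ℤ.∣ N * d ∣                       ≡⟨ ℤ.abs-* N d ⟩
      ℤ.∣ N ∣ ℕ.* ℤ.∣ d ∣               ∎
    D∣d : suc D-1 ℕ.∣ ℤ.∣ d ∣
    D∣d = Coprime.coprime-divisor (Coprime.sym (recompute (Coprime.coprime? _ _) coprime))
            (ℕ.divides ℤ.∣ n ∣ (trans (sym ∣n∣*D≡∣N∣*∣d∣) (cong (ℤ.∣ n ∣ ℕ.*_) (ℕ.*-identityʳ (suc D-1)))))

  infix 4 _≈_
  record _≈_ (x y : ℚ) : Set where
    constructor p∣by
    field
      quotient          : ℚ
      integral-quotient : Integral quotient
      multiple          : x ℚ.- y ≡ ι (+ p) ℚ.* quotient

  ≈⇒≡[modℚ] : ∀ {x y} → x ≈ y → x ≡ y [modℚ p ]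
  ≈⇒≡[modℚ] (p∣by z integral-z eq) = z , integral⇒pIntegral integral-z , eq

  ≈-reflexive : ∀ {x y} → x ≡ y → x ≈ y
  ≈-reflexive {x} refl = p∣by 0ℚ (integral-ι (+ 0)) (trans (ℚ.+-inverseʳ x) (sym (ℚ.*-zeroʳ (ι (+ p)))))

  ≈-sym : ∀ {x y} → x ≈ y → y ≈ x
  ≈-sym {x} {y} (p∣by z integral-z eq) = p∣by (ℚ.- z) (integral-neg integral-z) (begin
    y ℚ.- x                 ≡⟨ solve 2 (λ x y → y :- x := :- (x :- y)) refl x y ⟩
    ℚ.- (x ℚ.- y)           ≡⟨ cong ℚ.-_ eq ⟩
    ℚ.- (ι (+ p) ℚ.* z)     ≡⟨ solve 2 (λ a z → :- (a :* z) := a :* (:- z)) refl (ι (+ p)) z ⟩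
    ι (+ p) ℚ.* (ℚ.- z)     ∎)
    where open ≡-Reasoning

  ≈-trans : ∀ {x y w} → x ≈ y → y ≈ w → x ≈ w
  ≈-trans {x} {y} {w} (p∣by z₁ i₁ e₁) (p∣by z₂ i₂ e₂) = p∣by (z₁ ℚ.+ z₂) (integral-+ i₁ i₂) (begin
    x ℚ.- w                               ≡⟨ solve 3 (λ x y w → x :- w := (x :- y) :+ (y :- w)) refl x y w ⟩
    (x ℚ.- y) ℚ.+ (y ℚ.- w)               ≡⟨ cong₂ ℚ._+_ e₁ e₂ ⟩
    ι (+ p) ℚ.* z₁ ℚ.+ ι (+ p) ℚ.* z₂     ≡⟨ ℚ.*-distribˡ-+ (ι (+ p)) z₁ z₂ ⟨
    ι (+ p) ℚ.* (z₁ ℚ.+ z₂)               ∎)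
    where open ≡-Reasoning

  ≈-setoid : Setoid 0ℓ 0ℓ
  ≈-setoid = record
    { Carrier       = ℚ
    ; _≈_           = _≈_
    ; isEquivalence = record { refl = ≈-reflexive refl ; sym = ≈-sym ; trans = ≈-trans }
    }

  +-cong : ∀ {x y x′ y′} → x ≈ y → x′ ≈ y′ → x ℚ.+ x′ ≈ y ℚ.+ y′
  +-cong {x} {y} {x′} {y′} (p∣by z₁ i₁ e₁) (p∣by z₂ i₂ e₂) = p∣by (z₁ ℚ.+ z₂) (integral-+ i₁ i₂) (begin
    (x ℚ.+ x′) ℚ.- (y ℚ.+ y′)             ≡⟨ solve 4 (λ x y x′ y′ → (x :+ x′) :- (y :+ y′) := (x :- y) :+ (x′ :- y′)) refl x y x′ y′ ⟩
    (x ℚ.- y) ℚ.+ (x′ ℚ.- y′)             ≡⟨ cong₂ ℚ._+_ e₁ e₂ ⟩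
    ι (+ p) ℚ.* z₁ ℚ.+ ι (+ p) ℚ.* z₂     ≡⟨ ℚ.*-distribˡ-+ (ι (+ p)) z₁ z₂ ⟨
    ι (+ p) ℚ.* (z₁ ℚ.+ z₂)               ∎)
    where open ≡-Reasoning

  -‿cong : ∀ {x y} → x ≈ y → ℚ.- x ≈ ℚ.- y
  -‿cong {x} {y} (p∣by z integral-z eq) = p∣by (ℚ.- z) (integral-neg integral-z) (begin
    ℚ.- x ℚ.- ℚ.- y         ≡⟨ solve 2 (λ x y → :- x :- :- y := :- (x :- y)) refl x y ⟩
    ℚ.- (x ℚ.- y)           ≡⟨ cong ℚ.-_ eq ⟩
    ℚ.- (ι (+ p) ℚ.* z)     ≡⟨ solve 2 (λ a z → :- (a :* z) := a :* (:- z)) refl (ι (+ p)) z ⟩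
    ι (+ p) ℚ.* (ℚ.- z)     ∎)
    where open ≡-Reasoning

  *-congˡ : ∀ {w x y} → Integral w → x ≈ y → w ℚ.* x ≈ w ℚ.* y
  *-congˡ {w} {x} {y} integral-w (p∣by z integral-z eq) = p∣by (w ℚ.* z) (integral-* integral-w integral-z) (begin
    w ℚ.* x ℚ.- w ℚ.* y       ≡⟨ solve 3 (λ w x y → w :* x :- w :* y := w :* (x :- y)) refl w x y ⟩
    w ℚ.* (x ℚ.- y)           ≡⟨ cong (w ℚ.*_) eq ⟩
    w ℚ.* (ι (+ p) ℚ.* z)     ≡⟨ solve 3 (λ w a z → w :* (a :* z) := a :* (w :* z)) refl w (ι (+ p)) z ⟩
    ι (+ p) ℚ.* (w ℚ.* z)     ∎)
    where open ≡-Reasoning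

  ι-cong : ∀ {m n} → + p ∣ m - n → ι m ≈ ι n
  ι-cong {m} {n} (divides k eq) = p∣by (ι k) (integral-ι k)
    (trans (sym (ι-- m n)) (trans (cong ι (trans eq (ℤ.*-comm k (+ p)))) (ι-* (+ p) k)))

  *-cancelˡ : ∀ {x y d} → p ∤ d → ι d ℚ.* x ≈ ι d ℚ.* y → x ≈ y
  *-cancelˡ {x} {y} {d} p∤d (p∣by z integral-z eq) =
    p∣by ((ι (+ 1) ⊘ ι d) ℚ.* z) (integral-* (integral-⊘ (+ 1) {d} p∤d) integral-z) (*ι-cancelʳ (∤⇒≢0 {d} p∤d) (begin
      (x ℚ.- y) ℚ.* ι d                               ≡⟨ solve 3 (λ x y a → (x :- y) :* a := a :* x :- a :* y) refl x y (ι d) ⟩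
      ι d ℚ.* x ℚ.- ι d ℚ.* y                         ≡⟨ eq ⟩
      ι (+ p) ℚ.* z                                   ≡⟨ ℚ.*-identityʳ _ ⟨
      ι (+ p) ℚ.* z ℚ.* ι (+ 1)                       ≡⟨ cong (ι (+ p) ℚ.* z ℚ.*_) (⊘-inverseʳ (ι (+ 1)) (ι≢0 (∤⇒≢0 {d} p∤d))) ⟨
      ι (+ p) ℚ.* z ℚ.* ((ι (+ 1) ⊘ ι d) ℚ.* ι d)     ≡⟨ solve 4 (λ a z v b → a :* z :* (v :* b) := a :* (v :* z) :* b) refl (ι (+ p)) z (ι (+ 1) ⊘ ι d) (ι d) ⟩
      ι (+ p) ℚ.* ((ι (+ 1) ⊘ ι d) ℚ.* z) ℚ.* ι d     ∎))
    where open ≡-Reasoning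

  ⊘-≈ : ∀ {n d t} → p ∤ d → + p ∣ d * t + n → ι n ⊘ ι d ≈ ι (- t)
  ⊘-≈ {n} {d} {t} p∤d p∣dt+n = *-cancelˡ {d = d} p∤d (begin
    ι d ℚ.* (ι n ⊘ ι d)      ≡⟨ ι-*-⊘ d n n (∤⇒≢0 {d} p∤d) (ℤ.*-comm d n) ⟩
    ι n                      ≈⟨ ι-cong {n} {d * - t} (subst (+ p ∣_) (lemma d t n) p∣dt+n) ⟩
    ι (d * - t)              ≡⟨ ι-* d (- t) ⟩
    ι d ℚ.* ι (- t)          ∎)
    where
    open ≈-Reasoning ≈-setoid
    lemma : ∀ d t n → d * t + n ≡ n - d * - t
    lemma = solve-∀

  reciprocal-sum : ∀ x m t → m ℕ.* 3 ℕ.< p → sumℤ m (λ k → binomialTerm x p (suc k ℕ.* 3)) ≡ t * + p →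
                   sum1 m (λ k → ι ((- x) ^ (3 ℕ.* k)) ⊘ ι (+ k)) ≈ ι (- (+ 3 * t))
  reciprocal-sum x zero t _ 0≡t*p = ≈-reflexive (cong (λ s → ι (- (+ 3 * s))) (sym t≡0))
    where
    instance
      _ = prime⇒nonZero p-prime
    t≡0 : t ≡ + 0
    t≡0 = ℤ.*-cancelʳ-≡ t (+ 0) (+ p) (sym 0≡t*p)
  reciprocal-sum x (suc m) t 3m+3<p sum≡t*p with binomial-quotient p-prime (s≤s z≤n) 3m+3<p x
  ... | t′ , term≡t′*p , p∣jt′+n = begin
    sum1 m f ℚ.+ f (suc m)                        ≈⟨ +-cong (reciprocal-sum x m (t - t′) 3m<p previous≡) last ⟩
    ι (- (+ 3 * (t - t′))) ℚ.+ ι (- (+ 3 * t′))   ≡⟨ ι-+ (- (+ 3 * (t - t′))) (- (+ 3 * t′)) ⟨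
    ι (- (+ 3 * (t - t′)) + - (+ 3 * t′))          ≡⟨ cong ι (lemma t t′) ⟩
    ι (- (+ 3 * t))                               ∎
    where
    open ≈-Reasoning ≈-setoid
    f : ℕ → ℚ
    f k = ι ((- x) ^ (3 ℕ.* k)) ⊘ ι (+ k)
    3m<p : m ℕ.* 3 ℕ.< p
    3m<p = ℕ.<-trans (ℕ.m<n+m (m ℕ.* 3) (s≤s z≤n)) 3m+3<p
    previous≡ : sumℤ m (λ k → binomialTerm x p (suc k ℕ.* 3)) ≡ (t - t′) * + p
    previous≡ = trans (lemma₁ (sumℤ m g) (g m)) (trans (cong₂ _-_ sum≡t*p term≡t′*p) (lemma₂ t t′ (+ p)))
      where
      g : ℕ → ℤ
      g k = binomialTerm x p (suc k ℕ.* 3)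
      lemma₁ : ∀ s a → s ≡ s + a - a
      lemma₁ = solve-∀
      lemma₂ : ∀ t t′ d → t * d - t′ * d ≡ (t - t′) * d
      lemma₂ = solve-∀
    last : f (suc m) ≈ ι (- (+ 3 * t′))
    last = ⊘-≈ {(- x) ^ (3 ℕ.* suc m)} {+ suc m} {+ 3 * t′} (∤-< (s≤s z≤n) (ℕ.≤-<-trans (ℕ.m≤m*n (suc m) 3) 3m+3<p))
             (subst (+ p ∣_) (cong₂ _+_ (trans (cong (_* t′) (ℤ.pos-* (suc m) 3)) (ℤ.*-assoc (+ suc m) (+ 3) t′))
                                         (cong ((- x) ^_) (ℕ.*-comm (suc m) 3)))
                    p∣jt′+n)
    lemma : ∀ t t′ → - (+ 3 * (t - t′)) + - (+ 3 * t′) ≡ - (+ 3 * t)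
    lemma = solve-∀

  rightHandSide₁-≈ : ∀ a {S qc qa} t b s → + 3 * a * a ≢ + 0 →
                     S ≈ ι (- (+ 3 * t)) → ι (Φ₆ a) ℚ.* qc ≈ ι b → ι (a + + 1) ℚ.* qa ≡ ι s →
                     ι (+ 6 * a * a * a * Φ₆ a) ℚ.* rightHandSide₁ a S qc qa
                       ≈ ι (a * (- (+ 12) * Φ₆ a * t + + 2 * (+ 2 - a) * b + + 4 * Φ₆ a * s))
  rightHandSide₁-≈ a {S} {qc} {qa} t b s D≢0 S≈ qc≈ qa≡ = begin
    ι (+ 6 * a * a * a * c) ℚ.* rightHandSide₁ a S qc qa
      ≡⟨ rightHandSide₁-expansion a S qc qa D≢0 ⟩
    ι C₄ ℚ.* S ℚ.+ ι C₂ ℚ.* (ι c ℚ.* qc) ℚ.+ ι C₄ ℚ.* (ι (a + + 1) ℚ.* qa)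
      ≈⟨ +-cong (+-cong (*-congˡ (integral-ι C₄) S≈) (*-congˡ (integral-ι C₂) qc≈)) (≈-reflexive (cong (ι C₄ ℚ.*_) qa≡)) ⟩
    ι C₄ ℚ.* ι (- (+ 3 * t)) ℚ.+ ι C₂ ℚ.* ι b ℚ.+ ι C₄ ℚ.* ι s
      ≡⟨ cong₃ (λ x y z → x ℚ.+ y ℚ.+ z) (ι-* C₄ (- (+ 3 * t))) (ι-* C₂ b) (ι-* C₄ s) ⟨
    ι (C₄ * - (+ 3 * t)) ℚ.+ ι (C₂ * b) ℚ.+ ι (C₄ * s)
      ≡⟨ trans (ι-+ (C₄ * - (+ 3 * t) + C₂ * b) (C₄ * s)) (cong (ℚ._+ ι (C₄ * s)) (ι-+ (C₄ * - (+ 3 * t)) (C₂ * b))) ⟨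
    ι (C₄ * - (+ 3 * t) + C₂ * b + C₄ * s)
      ≡⟨ cong ι (lemma a t b s) ⟩
    ι (a * (- (+ 12) * c * t + + 2 * (+ 2 - a) * b + + 4 * c * s))
      ∎
    where
    open ≈-Reasoning ≈-setoid
    c = Φ₆ a
    C₄ = + 4 * a * c
    C₂ = + 2 * a * (+ 2 - a)
    lemma : ∀ a t b s → + 4 * a * (a * a - a + + 1) * - (+ 3 * t) + + 2 * a * (+ 2 - a) * b + + 4 * a * (a * a - a + + 1) * s
                      ≡ a * (- (+ 12) * (a * a - a + + 1) * t + + 2 * (+ 2 - a) * b + + 4 * (a * a - a + + 1) * s)
    lemma = solve-∀

rightHandSide₁-residue : ∀ {n} m a (p-prime : Prime (suc n)) V W →
                       m ℕ.* 3 ℕ.< suc n → suc n ∤ + 3 * a * a → total V ≡ a + + 1 → norm V ≡ Φ₆ a →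
                       trisection a (suc n) ≡ V +[ + suc n ] W →
                       sumℤ m (λ k → binomialTerm a (suc n) (suc k ℕ.* 3)) ≡ t₀ W * + suc n →
                       let open Congruence p-prime in
                       ι (+ 6 * a * a * a * Φ₆ a) ℚ.* rightHandSide₁ a (reciprocalSum a m) (q (suc n) (Φ₆ a)) (q (suc n) (a + + 1))
                         ≈ ι (lucasResidue a V W)
rightHandSide₁-residue {n} m a p-prime V W 3m<p p∤D total≡ norm≡ T≡ sum≡ =
  rightHandSide₁-≈ a (t₀ W) (polar V W) (total W) (∤⇒≢0 {+ 3 * a * a} p∤D) (reciprocal-sum a m (t₀ W) 3m<p sum≡) qc≈ qa≡
  where
  open Congruence p-prime
  open ≈-Reasoning ≈-setoid
  p = suc n
  c = Φ₆ a
  qc≈ : ι c ℚ.* q p c ≈ ι (polar V W)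
  qc≈ = begin
    ι c ℚ.* q p c                       ≡⟨ ι-*-⊘ c (c ^ n - + 1) (polar V W + + p * norm W) (λ ()) (norm-quotient {a} {n} V W norm≡ T≡) ⟩
    ι (polar V W + + p * norm W)        ≈⟨ ι-cong {polar V W + + p * norm W} {polar V W} (divides (norm W) (lemma (polar V W) (+ p) (norm W))) ⟩
    ι (polar V W)                       ∎
    where
    lemma : ∀ b d k → b + d * k - b ≡ k * d
    lemma = solve-∀
  qa≡ : ι (a + + 1) ℚ.* q p (a + + 1) ≡ ι (total W)
  qa≡ = ι-*-⊘ (a + + 1) ((a + + 1) ^ n - + 1) (total W) (λ ()) (total-quotient {a} {n} V W total≡ T≡)

lucas-congruence₁ : ∀ {p} m a → Prime p → p ≡ 1 ℕ.+ m ℕ.* 3 → p ∤ + 2 → p ∤ + 3 → p ∤ a → p ∤ Φ₆ a →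
                    (ι (u a (p ∸ 1)) ⊘ ι (+ p)) ≡ rightHandSide₁ a (reciprocalSum a m) (q p (Φ₆ a)) (q p (a + + 1)) [modℚ p ]
lucas-congruence₁ m a p-prime refl p∤2 p∤3 p∤a p∤c = ≈⇒≡[modℚ] {ι (u a n) ⊘ ι (+ p)} {rightHandSide₁ a (reciprocalSum a m) (q p (Φ₆ a)) (q p (a + + 1))} (*-cancelˡ {d = M} p∤M (begin
  ι M ℚ.* (ι (u a n) ⊘ ι (+ p))           ≡⟨ ι-*-⊘ M (u a n) (lucasResidue a V W) (λ ()) (lucas-quotient₁ a n W T≡) ⟩
  ι (lucasResidue a V W)                  ≈⟨ rightHandSide₁-residue m a p-prime V W (ℕ.n<1+n n) p∤D (lemma₁ a) (lemma₂ a) T≡ sum≡ ⟨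
  ι M ℚ.* rightHandSide₁ a (reciprocalSum a m) (q p (Φ₆ a)) (q p (a + + 1)) ∎))
  where
  open Congruence p-prime
  open ≈-Reasoning ≈-setoid
  n = m ℕ.* 3
  p = suc n
  V = ⟨ + 1 , a , + 0 ⟩
  frobenius = frobenius₁ m p-prime refl a
  W : Triple
  W = proj₁ frobenius
  T≡ : trisection a p ≡ V +[ + p ] W
  T≡ = proj₁ (proj₂ frobenius)
  sum≡ : sumℤ m (λ k → binomialTerm a p (suc k ℕ.* 3)) ≡ t₀ W * + p
  sum≡ = proj₂ (proj₂ frobenius)
  M = + 6 * a * a * a * Φ₆ a
  p∤D : p ∤ + 3 * a * a
  p∤D = ∤-* {+ 3 * a} {a} (∤-* {+ 3} {a} p∤3 p∤a) p∤a
  p∤M : p ∤ M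
  p∤M = ∤-* {+ 6 * a * a * a} {Φ₆ a} (∤-* {+ 6 * a * a} {a} (∤-* {+ 6 * a} {a} (∤-* {+ 6} {a} (∤-* {+ 2} {+ 3} p∤2 p∤3) p∤a) p∤a) p∤a) p∤c
  lemma₁ : ∀ a → + 1 + a + + 0 ≡ a + + 1
  lemma₁ = solve-∀
  lemma₂ : ∀ a → + 1 * + 1 + a * a + + 0 * + 0 - + 1 * a - a * + 0 - + 0 * + 1 ≡ a * a - a + + 1
  lemma₂ = solve-∀

lucas-congruence₂ : ∀ {p} m a → Prime p → p ≡ 2 ℕ.+ m ℕ.* 3 → p ∤ + 2 → p ∤ + 3 → p ∤ a →
                    (ι (u a (suc p)) ⊘ ι (+ p)) ≡ rightHandSide₂ a (reciprocalSum a m) (q p (Φ₆ a)) (q p (a + + 1)) [modℚ p ]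
lucas-congruence₂ m a p-prime refl p∤2 p∤3 p∤a = ≈⇒≡[modℚ] {ι (u a (suc p)) ⊘ ι (+ p)} {rightHandSide₂ a S qc qa} (*-cancelˡ {d = M} p∤M (begin
  ι M ℚ.* (ι (u a (suc p)) ⊘ ι (+ p))                    ≡⟨ ι-*-⊘ M (u a (suc p)) (- lucasResidue a V W) (λ ()) (lucas-quotient₂ a n W T≡) ⟩
  ι (- lucasResidue a V W)                              ≡⟨ ι-neg (lucasResidue a V W) ⟩
  ℚ.- ι (lucasResidue a V W)                            ≈⟨ -‿cong (rightHandSide₁-residue m a p-prime V W 3m<p p∤D (lemma₁ a) (lemma₂ a) T≡ sum≡) ⟨
  ℚ.- (ι (M * c) ℚ.* comb)                              ≡⟨ cong (λ x → ℚ.- (x ℚ.* comb)) (ι-* M c) ⟩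
  ℚ.- (ι M ℚ.* ι c ℚ.* comb)                            ≡⟨ solve 3 (λ m c x → :- (m :* c :* x) := m :* (:- (c :* x))) refl (ι M) (ι c) comb ⟩
  ι M ℚ.* ℚ.- (ι c ℚ.* comb)                            ≡⟨ cong (ι M ℚ.*_) (rightHandSide₂≡-Φ₆*rightHandSide₁ a S qc qa) ⟨
  ι M ℚ.* rightHandSide₂ a S qc qa                      ∎))
  where
  open Congruence p-prime
  open ≈-Reasoning ≈-setoid
  n = suc (m ℕ.* 3)
  p = suc n
  c = Φ₆ a
  V = ⟨ + 1 , + 0 , a ⟩
  frobenius = frobenius₂ m p-prime refl a
  W : Triple
  W = proj₁ frobenius
  T≡ : trisection a p ≡ V +[ + p ] W
  T≡ = proj₁ (proj₂ frobenius)
  sum≡ : sumℤ m (λ k → binomialTerm a p (suc k ℕ.* 3)) ≡ t₀ W * + p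
  sum≡ = proj₂ (proj₂ frobenius)
  M = + 6 * a * a * a
  S = reciprocalSum a m
  qc = q p c
  qa = q p (a + + 1)
  comb = rightHandSide₁ a S qc qa
  3m<p : m ℕ.* 3 ℕ.< p
  3m<p = ℕ.m<n+m (m ℕ.* 3) (s≤s z≤n)
  p∤D : p ∤ + 3 * a * a
  p∤D = ∤-* {+ 3 * a} {a} (∤-* {+ 3} {a} p∤3 p∤a) p∤a
  p∤M : p ∤ M
  p∤M = ∤-* {+ 6 * a * a} {a} (∤-* {+ 6 * a} {a} (∤-* {+ 6} {a} (∤-* {+ 2} {+ 3} p∤2 p∤3) p∤a) p∤a) p∤a
  lemma₁ : ∀ a → + 1 + + 0 + a ≡ a + + 1
  lemma₁ = solve-∀
  lemma₂ : ∀ a → + 1 * + 1 + + 0 * + 0 + a * a - + 1 * + 0 - + 0 * a - a * + 1 ≡ a * a - a + + 1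
  lemma₂ = solve-∀

∤-factors : ∀ {p} → Prime p → ∀ a → p ∤ + 3 * a * (+ 2 - a) * (a ^ 3 + + 1) → p ∤ + 3 × p ∤ a × p ∤ Φ₆ a
∤-factors {p} p-prime a p∤big =
    ∤-*ˡ (+ 3) (a * (+ 2 - a) * (a ^ 3 + + 1)) (subst (p ∤_) (lemma₁ a) p∤big)
  , ∤-*ˡ a (+ 3 * (+ 2 - a) * (a ^ 3 + + 1)) (subst (p ∤_) (lemma₂ a) p∤big)
  , ∤-*ˡ (Φ₆ a) (+ 3 * a * (+ 2 - a) * (a + + 1)) (subst (p ∤_) (lemma₃ a) p∤big)
  where
  open Congruence p-prime using (∤-*ˡ)
  lemma₁ : ∀ a → + 3 * a * (+ 2 - a) * (a * (a * (a * + 1)) + + 1) ≡ + 3 * (a * (+ 2 - a) * (a * (a * (a * + 1)) + + 1))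
  lemma₁ = solve-∀
  lemma₂ : ∀ a → + 3 * a * (+ 2 - a) * (a * (a * (a * + 1)) + + 1) ≡ a * (+ 3 * (+ 2 - a) * (a * (a * (a * + 1)) + + 1))
  lemma₂ = solve-∀
  lemma₃ : ∀ a → + 3 * a * (+ 2 - a) * (a * (a * (a * + 1)) + + 1) ≡ (a * a - a + + 1) * (+ 3 * a * (+ 2 - a) * (a + + 1))
  lemma₃ = solve-∀

p≡r+[p/3]*3 : ∀ p {r} → p % 3 ≡ r → p ≡ r ℕ.+ (p / 3) ℕ.* 3
p≡r+[p/3]*3 p {r} p%3≡r = trans (ℕ.m≡m%n+[m/n]*n p 3) (cong (ℕ._+ (p / 3) ℕ.* 3) p%3≡r)

[p∸r]/3≡p/3 : ∀ p {r} → p % 3 ≡ r → (p ∸ r) / 3 ≡ p / 3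
[p∸r]/3≡p/3 p {r} p%3≡r = begin
  (p ∸ r) / 3                         ≡⟨ cong (λ n → (n ∸ r) / 3) (p≡r+[p/3]*3 p p%3≡r) ⟩
  (r ℕ.+ (p / 3) ℕ.* 3 ∸ r) / 3       ≡⟨ cong (_/ 3) (ℕ.m+n∸m≡n r ((p / 3) ℕ.* 3)) ⟩
  (p / 3) ℕ.* 3 / 3                   ≡⟨ ℕ.m*n/n≡m (p / 3) 3 ⟩
  p / 3                               ∎
  where open ≡-Reasoning

theorem4p10 : (a : ℤ) (p : ℕ) → a ≢ + 0 → a ≢ + 1 → a ≢ -[1+ 0 ] → Prime p → p ≢ 2 → ¬ ((+ p) ℤD.∣ (+ 3 ℤ.* a ℤ.* (+ 2 ℤ.- a) ℤ.* (a ℤ.^ 3 ℤ.+ + 1))) → (p % 3 ≡ 1 → (ι (u a (p ∸ 1)) ⊘ ι (+ p)) ≡ ((ι (+ 2) ⊘ ι (+ 3 ℤ.* a ℤ.* a)) ℚ.* sum1 ((p ∸ 1) / 3) (λ k → ι ((ℤ.- a) ℤ.^ (3 ℕ.* k)) ⊘ ι (+ k)) ℚ.+ (ι (+ 1) ⊘ ι (+ 3 ℤ.* a ℤ.* a)) ℚ.* (ι (+ 2 ℤ.- a) ℚ.* q p (a ℤ.* a ℤ.- a ℤ.+ + 1) ℚ.+ ι (+ 2 ℤ.* (a ℤ.+ + 1)) ℚ.* q p (a ℤ.+ + 1))) [modℚ p ]) × (p % 3 ≡ 2 → (ι (u a (p ℕ.+ 1)) ⊘ ι (+ p)) ≡ (ℚ.-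 ((ι (+ 2 ℤ.* (a ℤ.* a ℤ.- a ℤ.+ + 1)) ⊘ ι (+ 3 ℤ.* a ℤ.* a)) ℚ.* sum1 ((p ∸ 2) / 3) (λ k → ι ((ℤ.- a) ℤ.^ (3 ℕ.* k)) ⊘ ι (+ k))) ℚ.- (ι (a ℤ.* a ℤ.- a ℤ.+ + 1) ⊘ ι (+ 3 ℤ.* a ℤ.* a)) ℚ.* (ι (+ 2 ℤ.- a) ℚ.* q p (a ℤ.* a ℤ.- a ℤ.+ + 1) ℚ.+ ι (+ 2 ℤ.* (a ℤ.+ + 1)) ℚ.* q p (a ℤ.+ + 1))) [modℚ p ])
theorem4p10 a p _ _ _ p-prime p≢2 p∤big = case₁ , case₂
  where
  open Congruence p-prime using (∤-2)
  factors = ∤-factors p-prime a p∤big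
  p∤3 = proj₁ factors
  p∤a = proj₁ (proj₂ factors)
  p∤Φ₆a = proj₂ (proj₂ factors)
  X : ℕ → ℚ
  X n = ι (u a n) ⊘ ι (+ p)
  case₁ : p % 3 ≡ 1 → X (p ∸ 1) ≡ rightHandSide₁ a (reciprocalSum a ((p ∸ 1) / 3)) (q p (Φ₆ a)) (q p (a + + 1)) [modℚ p ]
  case₁ p%3≡1 = subst (λ m → X (p ∸ 1) ≡ rightHandSide₁ a (reciprocalSum a m) (q p (Φ₆ a)) (q p (a + + 1)) [modℚ p ])
    (sym ([p∸r]/3≡p/3 p p%3≡1))
    (lucas-congruence₁ (p / 3) a p-prime (p≡r+[p/3]*3 p p%3≡1) (∤-2 p≢2) p∤3 p∤a p∤Φ₆a)
  case₂ : p % 3 ≡ 2 → X (p ℕ.+ 1) ≡ rightHandSide₂ a (reciprocalSum a ((p ∸ 2) / 3)) (q p (Φ₆ a)) (q p (a + + 1)) [modℚ p ]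
  case₂ p%3≡2 = subst₂ (λ n m → X n ≡ rightHandSide₂ a (reciprocalSum a m) (q p (Φ₆ a)) (q p (a + + 1)) [modℚ p ])
    (ℕ.+-comm 1 p) (sym ([p∸r]/3≡p/3 p p%3≡2))
    (lucas-congruence₂ (p / 3) a p-prime (p≡r+[p/3]*3 p p%3≡2) (∤-2 p≢2) p∤3 p∤a)
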